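{- Let $q$ be a prime power, let $k\in\mathbb{N}$ with $k\mid q-1$, and let $\zeta_k\in\mathbb{F}_q$ be a primitive $k$-th root of unity. Let $f\in\mathbb{F}_q[X]$, $f\neq X$, be a monic irreducible polynomial of degree $n$, let $\beta\in\mathbb{F}_{q^n}$ be a root of $f$, and let $m_{\beta^k}\in\mathbb{F}_q[X]$ be the minimal polynomial of $\beta^k$ over $\mathbb{F}_q$. Set $$t=\max\{m : m\mid\gcd(n,k),\ f(X)=g(X^m)\text{ for some } g\in\mathbb{F}_q[X]\}.$$ Then $$m_{\beta^k}(X^k)=\prod_{j=1}^{k/t}\zeta_k^{ -jn}f(\zeta_k^{j}X).$$ -}

module Defs where

open import Level using (Level; _⊔_) renaming (suc to lsuc)
open import Data.Nat as ℕ using (ℕ; zero; suc; _≤_; _<_)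
open import Data.Nat.Divisibility using (_∣_)
open import Data.Nat.GCD using (gcd)
open import Data.Nat.Primality using (Prime)
open import Data.Fin using (Fin)
open import Data.List using (List; []; _∷_; map)
open import Data.Product using (Σ; ∃; _×_; _,_)
open import Data.Sum using (_⊎_)
open import Relation.Nullary using (¬_)
open import Relation.Binary.PropositionalEquality as ≡ using (_≡_)
open import Algebra.Bundles using (CommutativeRing)
open import Algebra.Morphism.Structures using (module RingMorphisms)
open import Function.Bundles using (Bijection)

-- Fields: a commutative ring with 1 ≉ 0 in which every nonzero element
-- has a multiplicative inverse (inverse given as a total operation,
-- only constrained on nonzero elements).

record Field (c ℓ : Level) : Set (lsuc (c ⊔ ℓ)) where
  field
    commutativeRing : CommutativeRing c ℓ
  open CommutativeRing commutativeRing public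
  field
    _⁻¹       : Carrier → Carrier
    ⁻¹-cong   : ∀ {x y} → x ≈ y → (x ⁻¹) ≈ (y ⁻¹)
    1≉0       : ¬ (1# ≈ 0#)
    ⁻¹-inverse : ∀ x → ¬ (x ≈ 0#) → (x * (x ⁻¹)) ≈ 1#

HasSize : ∀ {c ℓ} → Field c ℓ → ℕ → Set (c ⊔ ℓ)
HasSize F q = Bijection (Field.setoid F) (≡.setoid (Fin q))

IsPrimePower : ℕ → Set
IsPrimePower q = Σ ℕ λ p → Σ ℕ λ e → Prime p × 1 ≤ e × q ≡ p ℕ.^ e

-- Polynomials over a field, as coefficient lists (constant term first).
-- Equality is coefficientwise (missing coefficients are 0).

module Poly {c ℓ} (F : Field c ℓ) where
  open Field F

  Pol : Set c
  Pol = List Carrier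

  coeff : Pol → ℕ → Carrier
  coeff []      _       = 0#
  coeff (a ∷ p) zero    = a
  coeff (a ∷ p) (suc i) = coeff p i

  infix 4 _≈ₚ_
  _≈ₚ_ : Pol → Pol → Set ℓ
  p ≈ₚ q = ∀ i → coeff p i ≈ coeff q i

  infixl 6 _+ₚ_
  _+ₚ_ : Pol → Pol → Pol
  []      +ₚ q       = q
  (a ∷ p) +ₚ []      = a ∷ p
  (a ∷ p) +ₚ (b ∷ q) = (a + b) ∷ (p +ₚ q)

  infixl 7 _·ₚ_ _*ₚ_
  _·ₚ_ : Carrier → Pol → Pol
  a ·ₚ p = map (a *_) p

  _*ₚ_ : Pol → Pol → Pol
  []      *ₚ q = []
  (a ∷ p) *ₚ q = (a ·ₚ q) +ₚ (0# ∷ (p *ₚ q))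

  const : Carrier → Pol
  const a = a ∷ []

  X : Pol
  X = 0# ∷ 1# ∷ []

  infixr 8 _^ₚ_ _^ᶠ_
  _^ₚ_ : Pol → ℕ → Pol
  p ^ₚ zero  = const 1#
  p ^ₚ suc n = p *ₚ (p ^ₚ n)

  _^ᶠ_ : Carrier → ℕ → Carrier
  x ^ᶠ zero  = 1#
  x ^ᶠ suc n = x * (x ^ᶠ n)

  compose : Pol → Pol → Pol
  compose []      g = []
  compose (a ∷ p) g = const a +ₚ (g *ₚ compose p g)

  eval : Pol → Carrier → Carrier
  eval []      x = 0#
  eval (a ∷ p) x = a + (x * eval p x)

  prod1 : ℕ → (ℕ → Pol) → Pol
  prod1 zero    h = const 1#
  prod1 (suc N) h = prod1 N h *ₚ h (suc N)

  IsConstant : Pol → Set ℓ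
  IsConstant p = ∀ i → 1 ≤ i → coeff p i ≈ 0#

  NonZeroPol : Pol → Set ℓ
  NonZeroPol p = ∃ λ i → ¬ (coeff p i ≈ 0#)

  HasDegree : Pol → ℕ → Set ℓ
  HasDegree p d = ¬ (coeff p d ≈ 0#) × (∀ i → d < i → coeff p i ≈ 0#)

  MonicOfDegree : Pol → ℕ → Set ℓ
  MonicOfDegree p d = coeff p d ≈ 1# × (∀ i → d < i → coeff p i ≈ 0#)

  Irreducible : Pol → Set (c ⊔ ℓ)
  Irreducible p = ¬ IsConstant p ×
    (∀ g h → p ≈ₚ g *ₚ h → IsConstant g ⊎ IsConstant h)

  IsPrimitiveRoot : ℕ → Carrier → Set ℓ
  IsPrimitiveRoot k ζ = (ζ ^ᶠ k) ≈ 1# × (∀ j → 1 ≤ j → j < k → ¬ ((ζ ^ᶠ j) ≈ 1#))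

  IsCompression : Pol → ℕ → ℕ → ℕ → Set (c ⊔ ℓ)
  IsCompression f n k m = m ∣ gcd n k × ∃ λ g → f ≈ₚ compose g (X ^ₚ m)

  IsMaxCompression : Pol → ℕ → ℕ → ℕ → Set (c ⊔ ℓ)
  IsMaxCompression f n k t =
    IsCompression f n k t × (∀ m → IsCompression f n k m → m ≤ t)

IsFieldHom : ∀ {c ℓ c' ℓ'} (K : Field c ℓ) (L : Field c' ℓ') →
             (Field.Carrier K → Field.Carrier L) → Set (c ⊔ ℓ ⊔ ℓ')
IsFieldHom K L ι = RingMorphisms.IsRingHomomorphism (Field.rawRing K) (Field.rawRing L) ι

mapPol : ∀ {c ℓ c' ℓ'} (K : Field c ℓ) (L : Field c' ℓ') →
         (Field.Carrier K → Field.Carrier L) → Poly.Pol K → Poly.Pol L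
mapPol K L ι p = map ι p

IsRootOf : ∀ {c ℓ c' ℓ'} (K : Field c ℓ) (L : Field c' ℓ') →
           (Field.Carrier K → Field.Carrier L) → Field.Carrier L → Poly.Pol K → Set ℓ'
IsRootOf K L ι α p = Field._≈_ L (Poly.eval L (mapPol K L ι p) α) (Field.0# L)

IsMinimalPolynomial : ∀ {c ℓ c' ℓ'} (K : Field c ℓ) (L : Field c' ℓ') →
  (Field.Carrier K → Field.Carrier L) → Field.Carrier L → Poly.Pol K → Set (c ⊔ ℓ ⊔ ℓ')
IsMinimalPolynomial K L ι α m =
  Σ ℕ λ d → Poly.MonicOfDegree K m d × IsRootOf K L ι α m ×
    (∀ g → Poly.NonZeroPol K g → IsRootOf K L ι α g →
       Σ ℕ λ e → Poly.HasDegree K g e × d ≤ e)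

{-# OPTIONS --safe #-}
-- Write ξ = ζ⁻¹ and f_j(X) = ξ^(jn) f(ζ^j X): a monic polynomial of degree n with root ξ^j β.
-- Since (ξ^j β)^k = β^k, every ξ^j β is a root of M(X) = m(X^k). For 0 < i < s the point ξ^i β
-- is not a root of f: otherwise f(ξ^i X) would be a scalar multiple of f, hence equal to f, so all
-- exponents of f would be divisible by (s / gcd(i, s)) t > t, contradicting the maximality of t.
-- So the roots ξ^j β (1 ≤ j ≤ s) of the f_j are not roots of the earlier factors, and
-- P = f_1 ⋯ f_s divides M. As f(ζ^s X) = f(X), P is invariant under X ↦ ζX, hence P = h(X^k) with
-- h monic of degree sn/k and h(β^k) = 0. Minimality gives deg m ≤ sn/k, i.e. deg M ≤ deg P, and
-- the quotient of the two monic polynomials M and P is 1.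

module Submission where

open import Defs
open import Level using (Level)
open import Data.Nat as ℕ using (ℕ; zero; suc; _≤_; _<_; z≤n; s≤s; NonZero; _∸_; _^_)
import Data.Nat.Properties as ℕP
open import Data.Nat.Induction using (<-rec)
open import Data.Nat.Divisibility as ℕD using (_∣_; divides)
open import Data.Nat.DivMod using (_%_; _/_; m≡m%n+[m/n]*n; m%n<n)
open import Data.Nat.GCD using (gcd; gcd[m,n]∣m; gcd[m,n]∣n; gcd-greatest; gcd[m,n]≢0; c*gcd[m,n]≡gcd[cm,cn])
open import Data.Nat.Primality using (prime)
open import Data.List using ([]; _∷_)
open import Data.Product using (Σ; _×_; _,_; proj₁; proj₂)
open import Data.Sum using (_⊎_; inj₁; inj₂)
open import Data.Empty using (⊥; ⊥-elim)
open import Relation.Nullary using (¬_; Dec; yes; no)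
open import Relation.Binary.PropositionalEquality as ≡ using (_≡_)
open import Relation.Binary.Bundles using (Setoid)
open import Relation.Binary.Definitions using (tri<; tri≈; tri>)
open import Algebra.Morphism.Structures using (module RingMorphisms)
open import Function.Bundles using (Bijection)
import Data.Fin.Properties as FinP
import Relation.Binary.Reasoning.Setoid as SetoidReasoning

module FieldProperties {c ℓ} (F : Field c ℓ) where
  open Field F hiding (zero)
  open Poly F using (_^ᶠ_)
  open SetoidReasoning setoid
  open import Algebra.Properties.CommutativeSemiring.Exp commutativeSemiring
    using (^-homo-*; ^-assocʳ; ^-distrib-*) renaming (_^_ to _^ʳ_)

  x⁻¹*x≈1 : ∀ x → ¬ (x ≈ 0#) → x ⁻¹ * x ≈ 1#
  x⁻¹*x≈1 x x≉0 = trans (*-comm _ _) (⁻¹-inverse x x≉0)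

  x*y≈0⇒y≈0 : ∀ {x y} → ¬ (x ≈ 0#) → x * y ≈ 0# → y ≈ 0#
  x*y≈0⇒y≈0 {x} {y} x≉0 xy≈0 = begin
    y                ≈⟨ sym (*-identityˡ y) ⟩
    1# * y           ≈⟨ *-congʳ (sym (x⁻¹*x≈1 x x≉0)) ⟩
    (x ⁻¹ * x) * y   ≈⟨ *-assoc _ _ _ ⟩
    x ⁻¹ * (x * y)   ≈⟨ *-congˡ xy≈0 ⟩
    x ⁻¹ * 0#        ≈⟨ zeroʳ _ ⟩
    0#               ∎

  *-≉0 : ∀ {x y} → ¬ (x ≈ 0#) → ¬ (y ≈ 0#) → ¬ (x * y ≈ 0#)
  *-≉0 x≉0 y≉0 xy≈0 = y≉0 (x*y≈0⇒y≈0 x≉0 xy≈0)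

  *-cancelʳ : ∀ {a x y} → ¬ (a ≈ 0#) → x * a ≈ y * a → x ≈ y
  *-cancelʳ {a} {x} {y} a≉0 xa≈ya = begin
    x                 ≈⟨ sym (*-identityʳ x) ⟩
    x * 1#            ≈⟨ *-congˡ (sym (⁻¹-inverse a a≉0)) ⟩
    x * (a * a ⁻¹)    ≈⟨ sym (*-assoc _ _ _) ⟩
    (x * a) * a ⁻¹    ≈⟨ *-congʳ xa≈ya ⟩
    (y * a) * a ⁻¹    ≈⟨ *-assoc _ _ _ ⟩
    y * (a * a ⁻¹)    ≈⟨ *-congˡ (⁻¹-inverse a a≉0) ⟩
    y * 1#            ≈⟨ *-identityʳ y ⟩
    y                 ∎

  ^ᶠ≡^ : ∀ x n → x ^ᶠ n ≡ x ^ʳ n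
  ^ᶠ≡^ x zero    = ≡.refl
  ^ᶠ≡^ x (suc n) = ≡.cong (x *_) (^ᶠ≡^ x n)

  ^ᶠ-congˡ : ∀ {x y} n → x ≈ y → x ^ᶠ n ≈ y ^ᶠ n
  ^ᶠ-congˡ zero    x≈y = refl
  ^ᶠ-congˡ (suc n) x≈y = *-cong x≈y (^ᶠ-congˡ n x≈y)

  ^ᶠ-homo-* : ∀ x m n → x ^ᶠ (m ℕ.+ n) ≈ x ^ᶠ m * x ^ᶠ n
  ^ᶠ-homo-* x m n rewrite ^ᶠ≡^ x (m ℕ.+ n) | ^ᶠ≡^ x m | ^ᶠ≡^ x n = ^-homo-* x m n

  ^ᶠ-assocʳ : ∀ x m n → (x ^ᶠ m) ^ᶠ n ≈ x ^ᶠ (m ℕ.* n)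
  ^ᶠ-assocʳ x m n rewrite ^ᶠ≡^ (x ^ᶠ m) n | ^ᶠ≡^ x m | ^ᶠ≡^ x (m ℕ.* n) = ^-assocʳ x m n

  ^ᶠ-distrib-* : ∀ x y n → (x * y) ^ᶠ n ≈ x ^ᶠ n * y ^ᶠ n
  ^ᶠ-distrib-* x y n rewrite ^ᶠ≡^ (x * y) n | ^ᶠ≡^ x n | ^ᶠ≡^ y n = ^-distrib-* x y n

  1^ᶠn≈1 : ∀ n → 1# ^ᶠ n ≈ 1#
  1^ᶠn≈1 zero    = refl
  1^ᶠn≈1 (suc n) = trans (*-identityˡ _) (1^ᶠn≈1 n)

  x^ᶠn≉0 : ∀ {x} n → ¬ (x ≈ 0#) → ¬ (x ^ᶠ n ≈ 0#)
  x^ᶠn≉0 zero    x≉0 = 1≉0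
  x^ᶠn≉0 (suc n) x≉0 = *-≉0 x≉0 (x^ᶠn≉0 n x≉0)

  x^ᶠn*x⁻¹^ᶠn≈1 : ∀ {x} n → ¬ (x ≈ 0#) → x ^ᶠ n * (x ⁻¹) ^ᶠ n ≈ 1#
  x^ᶠn*x⁻¹^ᶠn≈1 {x} n x≉0 =
    trans (sym (^ᶠ-distrib-* x (x ⁻¹) n)) (trans (^ᶠ-congˡ n (⁻¹-inverse x x≉0)) (1^ᶠn≈1 n))

  x*y≈1∧y≈1⇒x≈1 : ∀ {x y} → x * y ≈ 1# → y ≈ 1# → x ≈ 1#
  x*y≈1∧y≈1⇒x≈1 {x} xy≈1 y≈1 = trans (sym (*-identityʳ x)) (trans (*-congˡ (sym y≈1)) xy≈1)

module PolynomialRing {c ℓ} (F : Field c ℓ) where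
  open Field F hiding (zero)
  open Poly F
  private module ≈-Reasoning = SetoidReasoning setoid
  open import Algebra.Properties.CommutativeSemigroup +-commutativeSemigroup
    using (interchange)
  open import Algebra.Properties.Ring ring using (-1*x≈-x)

  -- _≈ₚ_ unfolds to a Π-type that hides both polynomials from unification; the record keeps them inferable.
  infix 4 _≋_
  record _≋_ (p q : Pol) : Set ℓ where
    constructor mk≋
    field ≋⇒≈ₚ : p ≈ₚ q
  open _≋_ public

  ≋-refl : ∀ {p} → p ≋ p
  ≋-refl = mk≋ λ i → refl

  ≋-sym : ∀ {p q} → p ≋ q → q ≋ p
  ≋-sym p≋q = mk≋ λ i → sym (≋⇒≈ₚ p≋q i)

  ≋-trans : ∀ {p q r} → p ≋ q → q ≋ r → p ≋ r
  ≋-trans p≋q q≋r = mk≋ λ i → trans (≋⇒≈ₚ p≋q i) (≋⇒≈ₚ q≋r i)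

  ≋-setoid : Setoid c ℓ
  ≋-setoid = record
    { Carrier = Pol ; _≈_ = _≋_
    ; isEquivalence = record { refl = ≋-refl ; sym = ≋-sym ; trans = ≋-trans } }

  shift : Pol → Pol
  shift p = 0# ∷ p

  ∷-cong : ∀ {a b p q} → a ≈ b → p ≋ q → a ∷ p ≋ b ∷ q
  ∷-cong a≈b p≋q = mk≋ λ { zero → a≈b ; (suc i) → ≋⇒≈ₚ p≋q i }

  ∷-injective : ∀ {a b p q} → a ∷ p ≋ b ∷ q → a ≈ b × p ≋ q
  ∷-injective e = ≋⇒≈ₚ e zero , mk≋ λ i → ≋⇒≈ₚ e (suc i)

  ∷-≋[] : ∀ {a p} → a ≈ 0# → p ≋ [] → a ∷ p ≋ []
  ∷-≋[] a≈0 p≋[] = mk≋ λ { zero → a≈0 ; (suc i) → ≋⇒≈ₚ p≋[] i }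

  ∷-≋[]⁻¹ : ∀ {a p} → a ∷ p ≋ [] → a ≈ 0# × p ≋ []
  ∷-≋[]⁻¹ e = ≋⇒≈ₚ e zero , mk≋ λ i → ≋⇒≈ₚ e (suc i)

  shift-cong : ∀ {p q} → p ≋ q → shift p ≋ shift q
  shift-cong = ∷-cong refl

  shift-≋[] : ∀ {p} → p ≋ [] → shift p ≋ []
  shift-≋[] = ∷-≋[] refl

  coeff-+ₚ : ∀ p q i → coeff (p +ₚ q) i ≈ coeff p i + coeff q i
  coeff-+ₚ []      q       i       = sym (+-identityˡ _)
  coeff-+ₚ (a ∷ p) []      zero    = sym (+-identityʳ _)
  coeff-+ₚ (a ∷ p) []      (suc i) = sym (+-identityʳ _)
  coeff-+ₚ (a ∷ p) (b ∷ q) zero    = refl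
  coeff-+ₚ (a ∷ p) (b ∷ q) (suc i) = coeff-+ₚ p q i

  coeff-·ₚ : ∀ a p i → coeff (a ·ₚ p) i ≈ a * coeff p i
  coeff-·ₚ a []      i       = sym (zeroʳ a)
  coeff-·ₚ a (b ∷ p) zero    = refl
  coeff-·ₚ a (b ∷ p) (suc i) = coeff-·ₚ a p i

  +ₚ-cong : ∀ {p p′ q q′} → p ≋ p′ → q ≋ q′ → p +ₚ q ≋ p′ +ₚ q′
  +ₚ-cong {p} {p′} {q} {q′} p≋p′ q≋q′ = mk≋ λ i → begin
    coeff (p +ₚ q) i          ≈⟨ coeff-+ₚ p q i ⟩
    coeff p i + coeff q i     ≈⟨ +-cong (≋⇒≈ₚ p≋p′ i) (≋⇒≈ₚ q≋q′ i) ⟩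
    coeff p′ i + coeff q′ i   ≈⟨ coeff-+ₚ p′ q′ i ⟨
    coeff (p′ +ₚ q′) i        ∎
    where open ≈-Reasoning

  +ₚ-congˡ : ∀ p {q q′} → q ≋ q′ → p +ₚ q ≋ p +ₚ q′
  +ₚ-congˡ p = +ₚ-cong (≋-refl {p})

  ·ₚ-cong : ∀ {a a′ p p′} → a ≈ a′ → p ≋ p′ → a ·ₚ p ≋ a′ ·ₚ p′
  ·ₚ-cong {a} {a′} {p} {p′} a≈a′ p≋p′ = mk≋ λ i → begin
    coeff (a ·ₚ p) i     ≈⟨ coeff-·ₚ a p i ⟩
    a * coeff p i        ≈⟨ *-cong a≈a′ (≋⇒≈ₚ p≋p′ i) ⟩
    a′ * coeff p′ i      ≈⟨ coeff-·ₚ a′ p′ i ⟨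
    coeff (a′ ·ₚ p′) i   ∎
    where open ≈-Reasoning

  ·ₚ-congˡ : ∀ a {p p′} → p ≋ p′ → a ·ₚ p ≋ a ·ₚ p′
  ·ₚ-congˡ a = ·ₚ-cong refl

  +ₚ-comm : ∀ p q → p +ₚ q ≋ q +ₚ p
  +ₚ-comm p q = mk≋ λ i →
    trans (coeff-+ₚ p q i) (trans (+-comm _ _) (sym (coeff-+ₚ q p i)))

  +ₚ-assoc : ∀ p q r → (p +ₚ q) +ₚ r ≋ p +ₚ (q +ₚ r)
  +ₚ-assoc p q r = mk≋ λ i → begin
    coeff ((p +ₚ q) +ₚ r) i               ≈⟨ coeff-+ₚ (p +ₚ q) r i ⟩
    coeff (p +ₚ q) i + coeff r i          ≈⟨ +-congʳ (coeff-+ₚ p q i) ⟩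
    (coeff p i + coeff q i) + coeff r i   ≈⟨ +-assoc _ _ _ ⟩
    coeff p i + (coeff q i + coeff r i)   ≈⟨ +-congˡ (coeff-+ₚ q r i) ⟨
    coeff p i + coeff (q +ₚ r) i          ≈⟨ coeff-+ₚ p (q +ₚ r) i ⟨
    coeff (p +ₚ (q +ₚ r)) i               ∎
    where open ≈-Reasoning

  +ₚ-interchange : ∀ p q r s → (p +ₚ q) +ₚ (r +ₚ s) ≋ (p +ₚ r) +ₚ (q +ₚ s)
  +ₚ-interchange p q r s = mk≋ λ i → begin
    coeff ((p +ₚ q) +ₚ (r +ₚ s)) i
      ≈⟨ trans (coeff-+ₚ (p +ₚ q) (r +ₚ s) i) (+-cong (coeff-+ₚ p q i) (coeff-+ₚ r s i)) ⟩
    (coeff p i + coeff q i) + (coeff r i + coeff s i)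
      ≈⟨ interchange _ _ _ _ ⟩
    (coeff p i + coeff r i) + (coeff q i + coeff s i)
      ≈⟨ trans (coeff-+ₚ (p +ₚ r) (q +ₚ s) i) (+-cong (coeff-+ₚ p r i) (coeff-+ₚ q s i)) ⟨
    coeff ((p +ₚ r) +ₚ (q +ₚ s)) i
      ∎
    where open ≈-Reasoning

  +ₚ-identityˡ : ∀ {z} p → z ≋ [] → z +ₚ p ≋ p
  +ₚ-identityˡ {z} p z≋[] = mk≋ λ i →
    trans (coeff-+ₚ z p i) (trans (+-congʳ (≋⇒≈ₚ z≋[] i)) (+-identityˡ _))

  +ₚ-identityʳ : ∀ {z} p → z ≋ [] → p +ₚ z ≋ p
  +ₚ-identityʳ {z} p z≋[] = ≋-trans (+ₚ-comm p z) (+ₚ-identityˡ p z≋[])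

  ·ₚ-distribˡ : ∀ a p q → a ·ₚ (p +ₚ q) ≋ a ·ₚ p +ₚ a ·ₚ q
  ·ₚ-distribˡ a p q = mk≋ λ i → begin
    coeff (a ·ₚ (p +ₚ q)) i          ≈⟨ trans (coeff-·ₚ a (p +ₚ q) i) (*-congˡ (coeff-+ₚ p q i)) ⟩
    a * (coeff p i + coeff q i)      ≈⟨ distribˡ _ _ _ ⟩
    a * coeff p i + a * coeff q i    ≈⟨ trans (coeff-+ₚ (a ·ₚ p) (a ·ₚ q) i) (+-cong (coeff-·ₚ a p i) (coeff-·ₚ a q i)) ⟨
    coeff (a ·ₚ p +ₚ a ·ₚ q) i       ∎
    where open ≈-Reasoning

  ·ₚ-distribʳ : ∀ a b p → (a + b) ·ₚ p ≋ a ·ₚ p +ₚ b ·ₚ p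
  ·ₚ-distribʳ a b p = mk≋ λ i → begin
    coeff ((a + b) ·ₚ p) i           ≈⟨ coeff-·ₚ (a + b) p i ⟩
    (a + b) * coeff p i              ≈⟨ distribʳ _ _ _ ⟩
    a * coeff p i + b * coeff p i    ≈⟨ trans (coeff-+ₚ (a ·ₚ p) (b ·ₚ p) i) (+-cong (coeff-·ₚ a p i) (coeff-·ₚ b p i)) ⟨
    coeff (a ·ₚ p +ₚ b ·ₚ p) i       ∎
    where open ≈-Reasoning

  ·ₚ-assoc : ∀ a b p → (a * b) ·ₚ p ≋ a ·ₚ (b ·ₚ p)
  ·ₚ-assoc a b p = mk≋ λ i → begin
    coeff ((a * b) ·ₚ p) i   ≈⟨ coeff-·ₚ (a * b) p i ⟩
    (a * b) * coeff p i      ≈⟨ *-assoc _ _ _ ⟩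
    a * (b * coeff p i)      ≈⟨ trans (coeff-·ₚ a (b ·ₚ p) i) (*-congˡ (coeff-·ₚ b p i)) ⟨
    coeff (a ·ₚ (b ·ₚ p)) i  ∎
    where open ≈-Reasoning

  ·ₚ-identityˡ : ∀ p → 1# ·ₚ p ≋ p
  ·ₚ-identityˡ p = mk≋ λ i → trans (coeff-·ₚ 1# p i) (*-identityˡ _)

  ·ₚ-zeroˡ : ∀ {a} p → a ≈ 0# → a ·ₚ p ≋ []
  ·ₚ-zeroˡ {a} p a≈0 = mk≋ λ i → trans (coeff-·ₚ a p i) (trans (*-congʳ a≈0) (zeroˡ _))

  ·ₚ-zeroʳ : ∀ a {p} → p ≋ [] → a ·ₚ p ≋ []
  ·ₚ-zeroʳ a {p} p≋[] = mk≋ λ i → trans (coeff-·ₚ a p i) (trans (*-congˡ (≋⇒≈ₚ p≋[] i)) (zeroʳ _))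

  shift-+ₚ : ∀ p q → shift (p +ₚ q) ≋ shift p +ₚ shift q
  shift-+ₚ p q = ∷-cong (sym (+-identityˡ _)) ≋-refl

  shift-·ₚ : ∀ a p → shift (a ·ₚ p) ≋ a ·ₚ shift p
  shift-·ₚ a p = ∷-cong (sym (zeroʳ a)) ≋-refl

  *ₚ-zeroˡ : ∀ {p} q → p ≋ [] → p *ₚ q ≋ []
  *ₚ-zeroˡ {[]}    q p≋[] = ≋-refl
  *ₚ-zeroˡ {a ∷ p} q p≋[] =
    ≋-trans (+ₚ-identityˡ (shift (p *ₚ q)) (·ₚ-zeroˡ q (proj₁ (∷-≋[]⁻¹ p≋[]))))
            (shift-≋[] (*ₚ-zeroˡ q (proj₂ (∷-≋[]⁻¹ p≋[]))))

  *ₚ-zeroʳ : ∀ p {q} → q ≋ [] → p *ₚ q ≋ []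
  *ₚ-zeroʳ []      q≋[] = ≋-refl
  *ₚ-zeroʳ (a ∷ p) {q} q≋[] =
    ≋-trans (+ₚ-identityˡ (shift (p *ₚ q)) (·ₚ-zeroʳ a q≋[])) (shift-≋[] (*ₚ-zeroʳ p q≋[]))

  *ₚ-congˡ : ∀ p {q q′} → q ≋ q′ → p *ₚ q ≋ p *ₚ q′
  *ₚ-congˡ []      q≋q′ = ≋-refl
  *ₚ-congˡ (a ∷ p) q≋q′ = +ₚ-cong (·ₚ-congˡ a q≋q′) (shift-cong (*ₚ-congˡ p q≋q′))

  *ₚ-congʳ : ∀ {p p′} q → p ≋ p′ → p *ₚ q ≋ p′ *ₚ q
  *ₚ-congʳ {[]}    {[]}     q e = ≋-refl
  *ₚ-congʳ {[]}    {a ∷ p′} q e = ≋-sym (*ₚ-zeroˡ q (≋-sym e))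
  *ₚ-congʳ {a ∷ p} {[]}     q e = *ₚ-zeroˡ q e
  *ₚ-congʳ {a ∷ p} {a′ ∷ p′} q e =
    +ₚ-cong (·ₚ-cong (proj₁ (∷-injective e)) ≋-refl) (shift-cong (*ₚ-congʳ q (proj₂ (∷-injective e))))

  *ₚ-cong : ∀ {p p′ q q′} → p ≋ p′ → q ≋ q′ → p *ₚ q ≋ p′ *ₚ q′
  *ₚ-cong {p} {p′} {q} p≋p′ q≋q′ = ≋-trans (*ₚ-congʳ q p≋p′) (*ₚ-congˡ p′ q≋q′)

  module ≋-Reasoning = SetoidReasoning ≋-setoid

  *ₚ-distribʳ : ∀ p q r → (p +ₚ q) *ₚ r ≋ p *ₚ r +ₚ q *ₚ r
  *ₚ-distribʳ []      q       r = ≋-refl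
  *ₚ-distribʳ (a ∷ p) []      r = ≋-sym (+ₚ-identityʳ _ ≋-refl)
  *ₚ-distribʳ (a ∷ p) (b ∷ q) r = begin
    (a + b) ·ₚ r +ₚ shift ((p +ₚ q) *ₚ r)
      ≈⟨ +ₚ-cong (·ₚ-distribʳ a b r) (≋-trans (shift-cong (*ₚ-distribʳ p q r)) (shift-+ₚ (p *ₚ r) (q *ₚ r))) ⟩
    (a ·ₚ r +ₚ b ·ₚ r) +ₚ (shift (p *ₚ r) +ₚ shift (q *ₚ r))
      ≈⟨ +ₚ-interchange (a ·ₚ r) (b ·ₚ r) (shift (p *ₚ r)) (shift (q *ₚ r)) ⟩
    (a ·ₚ r +ₚ shift (p *ₚ r)) +ₚ (b ·ₚ r +ₚ shift (q *ₚ r))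
      ∎
    where open ≋-Reasoning

  *ₚ-·ₚˡ : ∀ a p q → (a ·ₚ p) *ₚ q ≋ a ·ₚ (p *ₚ q)
  *ₚ-·ₚˡ a []      q = ≋-refl
  *ₚ-·ₚˡ a (b ∷ p) q = begin
    (a * b) ·ₚ q +ₚ shift ((a ·ₚ p) *ₚ q)
      ≈⟨ +ₚ-cong (·ₚ-assoc a b q) (≋-trans (shift-cong (*ₚ-·ₚˡ a p q)) (shift-·ₚ a (p *ₚ q))) ⟩
    a ·ₚ (b ·ₚ q) +ₚ a ·ₚ shift (p *ₚ q)
      ≈⟨ ·ₚ-distribˡ a (b ·ₚ q) (shift (p *ₚ q)) ⟨
    a ·ₚ (b ·ₚ q +ₚ shift (p *ₚ q))
      ∎
    where open ≋-Reasoning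

  shift-*ₚ : ∀ p q → shift p *ₚ q ≋ shift (p *ₚ q)
  shift-*ₚ p q = +ₚ-identityˡ _ (·ₚ-zeroˡ q refl)

  *ₚ-assoc : ∀ p q r → (p *ₚ q) *ₚ r ≋ p *ₚ (q *ₚ r)
  *ₚ-assoc []      q r = ≋-refl
  *ₚ-assoc (a ∷ p) q r = begin
    (a ·ₚ q +ₚ shift (p *ₚ q)) *ₚ r
      ≈⟨ *ₚ-distribʳ (a ·ₚ q) (shift (p *ₚ q)) r ⟩
    (a ·ₚ q) *ₚ r +ₚ shift (p *ₚ q) *ₚ r
      ≈⟨ +ₚ-cong (*ₚ-·ₚˡ a q r) (≋-trans (shift-*ₚ (p *ₚ q) r) (shift-cong (*ₚ-assoc p q r))) ⟩
    a ·ₚ (q *ₚ r) +ₚ shift (p *ₚ (q *ₚ r))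
      ∎
    where open ≋-Reasoning

  *ₚ-∷ʳ : ∀ p b q → p *ₚ (b ∷ q) ≋ b ·ₚ p +ₚ shift (p *ₚ q)
  *ₚ-∷ʳ []      b q = ≋-sym (shift-≋[] ≋-refl)
  *ₚ-∷ʳ (a ∷ p) b q =
    ∷-cong (+-congʳ (*-comm a b)) (≋-trans (+ₚ-congˡ (a ·ₚ q) (*ₚ-∷ʳ p b q)) swap)
    where
    open ≋-Reasoning
    swap : a ·ₚ q +ₚ (b ·ₚ p +ₚ shift (p *ₚ q)) ≋ b ·ₚ p +ₚ (a ·ₚ q +ₚ shift (p *ₚ q))
    swap = begin
      a ·ₚ q +ₚ (b ·ₚ p +ₚ shift (p *ₚ q))   ≈⟨ +ₚ-assoc (a ·ₚ q) (b ·ₚ p) _ ⟨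
      (a ·ₚ q +ₚ b ·ₚ p) +ₚ shift (p *ₚ q)   ≈⟨ +ₚ-cong (+ₚ-comm (a ·ₚ q) (b ·ₚ p)) ≋-refl ⟩
      (b ·ₚ p +ₚ a ·ₚ q) +ₚ shift (p *ₚ q)   ≈⟨ +ₚ-assoc (b ·ₚ p) (a ·ₚ q) _ ⟩
      b ·ₚ p +ₚ (a ·ₚ q +ₚ shift (p *ₚ q))   ∎

  *ₚ-comm : ∀ p q → p *ₚ q ≋ q *ₚ p
  *ₚ-comm []      q = ≋-sym (*ₚ-zeroʳ q ≋-refl)
  *ₚ-comm (a ∷ p) q = ≋-trans (+ₚ-congˡ (a ·ₚ q) (shift-cong (*ₚ-comm p q))) (≋-sym (*ₚ-∷ʳ q a p))

  *ₚ-·ₚʳ : ∀ a p q → p *ₚ (a ·ₚ q) ≋ a ·ₚ (p *ₚ q)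
  *ₚ-·ₚʳ a p q = ≋-trans (*ₚ-comm p _) (≋-trans (*ₚ-·ₚˡ a q p) (·ₚ-congˡ a (*ₚ-comm q p)))

  const-*ₚ : ∀ a p → const a *ₚ p ≋ a ·ₚ p
  const-*ₚ a p = +ₚ-identityʳ _ (shift-≋[] ≋-refl)

  *ₚ-identityˡ : ∀ p → const 1# *ₚ p ≋ p
  *ₚ-identityˡ p = ≋-trans (const-*ₚ 1# p) (·ₚ-identityˡ p)

  *ₚ-identityʳ : ∀ p → p *ₚ const 1# ≋ p
  *ₚ-identityʳ p = ≋-trans (*ₚ-comm p _) (*ₚ-identityˡ p)

  X*ₚ : ∀ p → X *ₚ p ≋ shift p
  X*ₚ p = ≋-trans (shift-*ₚ (const 1#) p) (shift-cong (*ₚ-identityˡ p))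

  infixl 6 _-ₚ_
  _-ₚ_ : Pol → Pol → Pol
  p -ₚ q = p +ₚ (- 1#) ·ₚ q

  coeff-[-ₚ] : ∀ p q i → coeff (p -ₚ q) i ≈ coeff p i - coeff q i
  coeff-[-ₚ] p q i =
    trans (coeff-+ₚ p _ i) (+-congˡ (trans (coeff-·ₚ (- 1#) q i) (-1*x≈-x (coeff q i))))

  ≋-[-ₚ]+ₚ : ∀ p q → p ≋ (p -ₚ q) +ₚ q
  ≋-[-ₚ]+ₚ p q = mk≋ λ i → begin
    coeff p i                            ≈⟨ +-identityʳ _ ⟨
    coeff p i + 0#                       ≈⟨ +-congˡ (-‿inverseˡ _) ⟨
    coeff p i + (- coeff q i + coeff q i) ≈⟨ +-assoc _ _ _ ⟨
    (coeff p i - coeff q i) + coeff q i  ≈⟨ trans (coeff-+ₚ (p -ₚ q) q i) (+-congʳ (coeff-[-ₚ] p q i)) ⟨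
    coeff ((p -ₚ q) +ₚ q) i              ∎
    where open ≈-Reasoning

  infix 4 _∣ₚ_
  _∣ₚ_ : Pol → Pol → Set (c Level.⊔ ℓ)
  p ∣ₚ g = Σ Pol λ q → g ≋ p *ₚ q

  prod1-cong : ∀ r {h h′} → (∀ j → h j ≋ h′ j) → prod1 r h ≋ prod1 r h′
  prod1-cong zero    h≋h′ = ≋-refl
  prod1-cong (suc r) h≋h′ = *ₚ-cong (prod1-cong r h≋h′) (h≋h′ (suc r))

  prod1-sucˡ : ∀ r h → prod1 (suc r) h ≋ h 1 *ₚ prod1 r (λ j → h (suc j))
  prod1-sucˡ zero    h = ≋-trans (*ₚ-identityˡ (h 1)) (≋-sym (*ₚ-identityʳ (h 1)))
  prod1-sucˡ (suc r) h = ≋-trans (*ₚ-congʳ (h (suc (suc r))) (prod1-sucˡ r h))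
                                 (*ₚ-assoc (h 1) (prod1 r (λ j → h (suc j))) (h (suc (suc r))))

  prod1-rotate : ∀ r h → h (suc r) ≋ h 1 → prod1 r (λ j → h (suc j)) ≋ prod1 r h
  prod1-rotate zero    h _ = ≋-refl
  prod1-rotate (suc r) h h[2+r]≋h[1] = begin
    prod1 r (λ j → h (suc j)) *ₚ h (suc (suc r))   ≈⟨ *ₚ-congˡ (prod1 r (λ j → h (suc j))) h[2+r]≋h[1] ⟩
    prod1 r (λ j → h (suc j)) *ₚ h 1               ≈⟨ *ₚ-comm _ (h 1) ⟩
    h 1 *ₚ prod1 r (λ j → h (suc j))               ≈⟨ prod1-sucˡ r h ⟨
    prod1 (suc r) h                                ∎
    where open ≋-Reasoning

module PolynomialDegree {c ℓ} (F : Field c ℓ) where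
  open Field F hiding (zero)
  open Poly F
  open PolynomialRing F
  open FieldProperties F using (*-≉0)
  private module ≈-Reasoning = SetoidReasoning setoid

  DegreeAtMost : Pol → ℕ → Set ℓ
  DegreeAtMost p d = ∀ i → d < i → coeff p i ≈ 0#

  DegreeBelow : Pol → ℕ → Set ℓ
  DegreeBelow p d = ∀ i → d ≤ i → coeff p i ≈ 0#

  degreeAtMost-cong : ∀ {p q d} → p ≋ q → DegreeAtMost p d → DegreeAtMost q d
  degreeAtMost-cong p≋q p≤d i d<i = trans (sym (≋⇒≈ₚ p≋q i)) (p≤d i d<i)

  hasDegree-cong : ∀ {p q d} → p ≋ q → HasDegree p d → HasDegree q d
  hasDegree-cong {p} p≋q (lead≉0 , p≤d) =
    (λ lead≈0 → lead≉0 (trans (≋⇒≈ₚ p≋q _) lead≈0)) , degreeAtMost-cong {p} p≋q p≤d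

  monic⇒hasDegree : ∀ {p d} → MonicOfDegree p d → HasDegree p d
  monic⇒hasDegree (lead≈1 , p≤d) = (λ lead≈0 → 1≉0 (trans (sym lead≈1) lead≈0)) , p≤d

  hasDegree-unique : ∀ {p d e} → HasDegree p d → HasDegree p e → d ≡ e
  hasDegree-unique {d = d} {e} (lead-d≉0 , p≤d) (lead-e≉0 , p≤e) with ℕP.<-cmp d e
  ... | tri< d<e _ _ = ⊥-elim (lead-e≉0 (p≤d e d<e))
  ... | tri≈ _ d≡e _ = d≡e
  ... | tri> _ _ e<d = ⊥-elim (lead-d≉0 (p≤e d e<d))

  hasDegree⇒< : ∀ {p d e} → HasDegree p d → DegreeBelow p e → d < e
  hasDegree⇒< {d = d} {e} (lead≉0 , _) p<e with ℕP.<-≤-connex d e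
  ... | inj₁ d<e = d<e
  ... | inj₂ e≤d = ⊥-elim (lead≉0 (p<e d e≤d))

  degreeAtMost0⇒≋const : ∀ p → DegreeAtMost p 0 → p ≋ const (coeff p 0)
  degreeAtMost0⇒≋const p p≤0 = mk≋ λ { zero → refl ; (suc i) → p≤0 (suc i) (s≤s z≤n) }

  ·ₚ-degreeAtMost : ∀ a {p d} → DegreeAtMost p d → DegreeAtMost (a ·ₚ p) d
  ·ₚ-degreeAtMost a {p} p≤d i d<i = trans (coeff-·ₚ a p i) (trans (*-congˡ (p≤d i d<i)) (zeroʳ a))

  ∷-degreeAtMost0⇒≋[] : ∀ {x p} → DegreeAtMost (x ∷ p) 0 → p ≋ []
  ∷-degreeAtMost0⇒≋[] p≤0 = mk≋ λ j → p≤0 (suc j) (s≤s z≤n)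

  *ₚ-degreeAtMost : ∀ p q a b → DegreeAtMost p a → DegreeAtMost q b → DegreeAtMost (p *ₚ q) (a ℕ.+ b)
  *ₚ-degreeAtMost []      q a       b p≤a q≤b i       _ = refl
  *ₚ-degreeAtMost (x ∷ p) q zero    b p≤0 q≤b i       b<i = begin
    coeff (x ·ₚ q +ₚ shift (p *ₚ q)) i          ≈⟨ coeff-+ₚ (x ·ₚ q) (shift (p *ₚ q)) i ⟩
    coeff (x ·ₚ q) i + coeff (shift (p *ₚ q)) i ≈⟨ +-cong (·ₚ-degreeAtMost x {q} q≤b i b<i)
                                                           (≋⇒≈ₚ (shift-≋[] (*ₚ-zeroˡ q (∷-degreeAtMost0⇒≋[] {x} {p} p≤0))) i) ⟩
    0# + 0#                                     ≈⟨ +-identityˡ _ ⟩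
    0#                                          ∎
    where open ≈-Reasoning
  *ₚ-degreeAtMost (x ∷ p) q (suc a) b p≤a q≤b zero    ()
  *ₚ-degreeAtMost (x ∷ p) q (suc a) b p≤a q≤b (suc i) (s≤s a+b<i) = begin
    coeff (x ·ₚ q +ₚ shift (p *ₚ q)) (suc i)    ≈⟨ coeff-+ₚ (x ·ₚ q) (shift (p *ₚ q)) (suc i) ⟩
    coeff (x ·ₚ q) (suc i) + coeff (p *ₚ q) i   ≈⟨ +-cong (·ₚ-degreeAtMost x {q} q≤b (suc i) b<1+i)
                                                           (*ₚ-degreeAtMost p q a b (λ j a<j → p≤a (suc j) (s≤s a<j)) q≤b i a+b<i) ⟩
    0# + 0#                                     ≈⟨ +-identityˡ _ ⟩
    0#                                          ∎
    where
    open ≈-Reasoning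
    b<1+i : b < suc i
    b<1+i = s≤s (ℕP.≤-trans (ℕP.m≤n+m b a) (ℕP.<⇒≤ a+b<i))

  coeff-*ₚ-top : ∀ p q a b → DegreeAtMost p a → DegreeAtMost q b →
                 coeff (p *ₚ q) (a ℕ.+ b) ≈ coeff p a * coeff q b
  coeff-*ₚ-top []      q a       b p≤a q≤b = sym (zeroˡ _)
  coeff-*ₚ-top (x ∷ p) q zero    b p≤0 q≤b = begin
    coeff (x ·ₚ q +ₚ shift (p *ₚ q)) b          ≈⟨ coeff-+ₚ (x ·ₚ q) (shift (p *ₚ q)) b ⟩
    coeff (x ·ₚ q) b + coeff (shift (p *ₚ q)) b ≈⟨ +-cong (coeff-·ₚ x q b)
                                                           (≋⇒≈ₚ (shift-≋[] (*ₚ-zeroˡ q (∷-degreeAtMost0⇒≋[] {x} {p} p≤0))) b) ⟩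
    x * coeff q b + 0#                          ≈⟨ +-identityʳ _ ⟩
    x * coeff q b                               ∎
    where open ≈-Reasoning
  coeff-*ₚ-top (x ∷ p) q (suc a) b p≤a q≤b = begin
    coeff (x ·ₚ q +ₚ shift (p *ₚ q)) (suc (a ℕ.+ b))
      ≈⟨ coeff-+ₚ (x ·ₚ q) (shift (p *ₚ q)) (suc (a ℕ.+ b)) ⟩
    coeff (x ·ₚ q) (suc (a ℕ.+ b)) + coeff (p *ₚ q) (a ℕ.+ b)
      ≈⟨ +-cong (·ₚ-degreeAtMost x {q} q≤b _ (s≤s (ℕP.m≤n+m b a)))
                (coeff-*ₚ-top p q a b (λ j a<j → p≤a (suc j) (s≤s a<j)) q≤b) ⟩
    0# + coeff p a * coeff q b
      ≈⟨ +-identityˡ _ ⟩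
    coeff p a * coeff q b
      ∎
    where open ≈-Reasoning

  *ₚ-monic : ∀ {p q a b} → MonicOfDegree p a → MonicOfDegree q b → MonicOfDegree (p *ₚ q) (a ℕ.+ b)
  *ₚ-monic {p} {q} {a} {b} (p-lead , p≤a) (q-lead , q≤b) =
    trans (coeff-*ₚ-top p q a b p≤a q≤b) (trans (*-cong p-lead q-lead) (*-identityˡ _)) ,
    *ₚ-degreeAtMost p q a b p≤a q≤b

  *ₚ-hasDegree : ∀ {p q a b} → HasDegree p a → HasDegree q b → HasDegree (p *ₚ q) (a ℕ.+ b)
  *ₚ-hasDegree {p} {q} {a} {b} (p-lead , p≤a) (q-lead , q≤b) =
    (λ top≈0 → *-≉0 p-lead q-lead (trans (sym (coeff-*ₚ-top p q a b p≤a q≤b)) top≈0)) ,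
    *ₚ-degreeAtMost p q a b p≤a q≤b

  record Division (g d : Pol) (e : ℕ) : Set (c Level.⊔ ℓ) where
    constructor division
    field
      quotient remainder : Pol
      g≋qd+r             : g ≋ quotient *ₚ d +ₚ remainder
      remainder<e        : DegreeBelow remainder e

  divMonic : ∀ {d e} → MonicOfDegree d e → ∀ g → Division g d e
  divMonic {d} {e} d-monic [] = division [] [] ≋-refl (λ i _ → refl)
  divMonic {d} {e} d-monic@(d-lead , d≤e) (a ∷ g) with divMonic d-monic g
  ... | division Q R g≋Qd+R R<e = division (lead ∷ Q) R′ step R′<e
    where
    open ≋-Reasoning
    lead = coeff (a ∷ R) e
    R′ = (a ∷ R) -ₚ lead ·ₚ d
    R′<e : DegreeBelow R′ e
    R′<e i e≤i with ℕP.≤⇒≤′ e≤i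
    ... | ℕ.≤′-refl = trans (coeff-[-ₚ] (a ∷ R) (lead ·ₚ d) e)
      (trans (+-congˡ (-‿cong (trans (coeff-·ₚ lead d e) (trans (*-congˡ d-lead) (*-identityʳ lead)))))
             (-‿inverseʳ lead))
    ... | ℕ.≤′-step {n = i′} e≤′i′ = trans (coeff-[-ₚ] (a ∷ R) (lead ·ₚ d) (suc i′))
      (trans (+-cong (R<e i′ (ℕP.≤′⇒≤ e≤′i′))
                     (-‿cong (·ₚ-degreeAtMost lead {d} d≤e _ (s≤s (ℕP.≤′⇒≤ e≤′i′)))))
             (-‿inverseʳ 0#))
    step : a ∷ g ≋ (lead ∷ Q) *ₚ d +ₚ R′
    step = begin
      a ∷ g                                       ≈⟨ ∷-cong (sym (+-identityˡ a)) g≋Qd+R ⟩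
      shift (Q *ₚ d) +ₚ (a ∷ R)                   ≈⟨ +ₚ-congˡ (shift (Q *ₚ d)) (≋-[-ₚ]+ₚ (a ∷ R) (lead ·ₚ d)) ⟩
      shift (Q *ₚ d) +ₚ (R′ +ₚ lead ·ₚ d)         ≈⟨ +ₚ-congˡ (shift (Q *ₚ d)) (+ₚ-comm R′ (lead ·ₚ d)) ⟩
      shift (Q *ₚ d) +ₚ (lead ·ₚ d +ₚ R′)         ≈⟨ +ₚ-assoc (shift (Q *ₚ d)) (lead ·ₚ d) R′ ⟨
      (shift (Q *ₚ d) +ₚ lead ·ₚ d) +ₚ R′         ≈⟨ +ₚ-cong (+ₚ-comm (shift (Q *ₚ d)) (lead ·ₚ d)) ≋-refl ⟩
      (lead ·ₚ d +ₚ shift (Q *ₚ d)) +ₚ R′         ∎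

  module WithDecidableEquality (_≟_ : ∀ x y → Dec (x ≈ y)) where

    degree? : ∀ p → p ≋ [] ⊎ Σ ℕ (HasDegree p)
    degree? [] = inj₁ ≋-refl
    degree? (a ∷ p) with degree? p
    ... | inj₂ (d , lead≉0 , p≤d) =
      inj₂ (suc d , lead≉0 , λ { zero () ; (suc i) (s≤s d<i) → p≤d i d<i })
    ... | inj₁ p≋[] with a ≟ 0#
    ...   | yes a≈0 = inj₁ (∷-≋[] a≈0 p≋[])
    ...   | no  a≉0 = inj₂ (0 , a≉0 , λ { zero () ; (suc i) _ → ≋⇒≈ₚ p≋[] i })

    degreeBelow-cases : ∀ {p e} → DegreeBelow p e → p ≋ [] ⊎ Σ ℕ λ d → HasDegree p d × d < e
    degreeBelow-cases {p} p<e with degree? p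
    ... | inj₁ p≋[]        = inj₁ p≋[]
    ... | inj₂ (d , p-deg) = inj₂ (d , p-deg , hasDegree⇒< {p} p-deg p<e)

    factor-of-no-larger-degree : ∀ {g p q a b} → g ≋ p *ₚ q → HasDegree p a → HasDegree g b → b ≤ a →
                                 b ≡ a × q ≋ const (coeff q 0)
    factor-of-no-larger-degree {g} {p} {q} {a} {b} g≋pq p-deg g-deg b≤a with degree? q
    ... | inj₁ q≋[] = ⊥-elim (proj₁ g-deg (≋⇒≈ₚ (≋-trans g≋pq (*ₚ-zeroʳ p q≋[])) b))
    ... | inj₂ (e , q-deg) = b≡a , degreeAtMost0⇒≋const q (≡.subst (DegreeAtMost q) e≡0 (proj₂ q-deg))
      where
      b≡a+e : b ≡ a ℕ.+ e
      b≡a+e = hasDegree-unique {g} g-deg (hasDegree-cong {p *ₚ q} (≋-sym g≋pq) (*ₚ-hasDegree {p} {q} p-deg q-deg))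
      e≡0 : e ≡ 0
      e≡0 = ℕP.n≤0⇒n≡0 (ℕP.+-cancelˡ-≤ a e 0 (≡.subst₂ _≤_ b≡a+e (≡.sym (ℕP.+-identityʳ a)) b≤a))
      b≡a : b ≡ a
      b≡a = ≡.trans b≡a+e (≡.trans (≡.cong (a ℕ.+_) e≡0) (ℕP.+-identityʳ a))

module Substitution {c ℓ} (F : Field c ℓ) where
  open Field F hiding (zero)
  open Poly F
  open PolynomialRing F
  open PolynomialDegree F using (DegreeAtMost)
  open FieldProperties F using (^ᶠ-congˡ; ^ᶠ-distrib-*; 1^ᶠn≈1; *-cancelʳ)
  private module ≈-Reasoning = SetoidReasoning setoid
  open import Algebra.Properties.CommutativeSemigroup *-commutativeSemigroup
    using (x∙yz≈y∙xz)

  scale : Carrier → Pol → Pol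
  scale a []      = []
  scale a (b ∷ p) = b ∷ a ·ₚ scale a p

  coeff-scale : ∀ a p i → coeff (scale a p) i ≈ a ^ᶠ i * coeff p i
  coeff-scale a []      i       = sym (zeroʳ _)
  coeff-scale a (b ∷ p) zero    = sym (*-identityˡ b)
  coeff-scale a (b ∷ p) (suc i) =
    trans (coeff-·ₚ a (scale a p) i) (trans (*-congˡ (coeff-scale a p i)) (sym (*-assoc _ _ _)))

  scale-cong : ∀ {a b p q} → a ≈ b → p ≋ q → scale a p ≋ scale b q
  scale-cong {a} {b} {p} {q} a≈b p≋q = mk≋ λ i →
    trans (coeff-scale a p i) (trans (*-cong (^ᶠ-congˡ i a≈b) (≋⇒≈ₚ p≋q i)) (sym (coeff-scale b q i)))

  scale-identity : ∀ {a} p → a ≈ 1# → scale a p ≋ p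
  scale-identity {a} p a≈1 = mk≋ λ i →
    trans (coeff-scale a p i) (trans (*-congʳ (trans (^ᶠ-congˡ i a≈1) (1^ᶠn≈1 i))) (*-identityˡ _))

  scale-scale : ∀ a b p → scale a (scale b p) ≋ scale (a * b) p
  scale-scale a b p = mk≋ λ i → begin
    coeff (scale a (scale b p)) i      ≈⟨ trans (coeff-scale a (scale b p) i) (*-congˡ (coeff-scale b p i)) ⟩
    a ^ᶠ i * (b ^ᶠ i * coeff p i)     ≈⟨ *-assoc _ _ _ ⟨
    (a ^ᶠ i * b ^ᶠ i) * coeff p i     ≈⟨ *-congʳ (^ᶠ-distrib-* a b i) ⟨
    (a * b) ^ᶠ i * coeff p i          ≈⟨ coeff-scale (a * b) p i ⟨
    coeff (scale (a * b) p) i          ∎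
    where open ≈-Reasoning

  scale-+ₚ : ∀ a p q → scale a (p +ₚ q) ≋ scale a p +ₚ scale a q
  scale-+ₚ a p q = mk≋ λ i → begin
    coeff (scale a (p +ₚ q)) i                   ≈⟨ trans (coeff-scale a (p +ₚ q) i) (*-congˡ (coeff-+ₚ p q i)) ⟩
    a ^ᶠ i * (coeff p i + coeff q i)             ≈⟨ distribˡ _ _ _ ⟩
    a ^ᶠ i * coeff p i + a ^ᶠ i * coeff q i      ≈⟨ +-cong (coeff-scale a p i) (coeff-scale a q i) ⟨
    coeff (scale a p) i + coeff (scale a q) i    ≈⟨ coeff-+ₚ (scale a p) (scale a q) i ⟨
    coeff (scale a p +ₚ scale a q) i             ∎
    where open ≈-Reasoning

  scale-·ₚ : ∀ a b p → scale a (b ·ₚ p) ≋ b ·ₚ scale a p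
  scale-·ₚ a b p = mk≋ λ i → begin
    coeff (scale a (b ·ₚ p)) i    ≈⟨ trans (coeff-scale a (b ·ₚ p) i) (*-congˡ (coeff-·ₚ b p i)) ⟩
    a ^ᶠ i * (b * coeff p i)      ≈⟨ x∙yz≈y∙xz _ _ _ ⟩
    b * (a ^ᶠ i * coeff p i)      ≈⟨ trans (coeff-·ₚ b (scale a p) i) (*-congˡ (coeff-scale a p i)) ⟨
    coeff (b ·ₚ scale a p) i      ∎
    where open ≈-Reasoning

  scale-*ₚ : ∀ a p q → scale a (p *ₚ q) ≋ scale a p *ₚ scale a q
  scale-*ₚ a []      q = ≋-refl
  scale-*ₚ a (b ∷ p) q = begin
    scale a (b ·ₚ q +ₚ shift (p *ₚ q))
      ≈⟨ scale-+ₚ a (b ·ₚ q) (shift (p *ₚ q)) ⟩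
    scale a (b ·ₚ q) +ₚ shift (a ·ₚ scale a (p *ₚ q))
      ≈⟨ +ₚ-cong (scale-·ₚ a b q) (shift-cong (·ₚ-congˡ a (scale-*ₚ a p q))) ⟩
    b ·ₚ scale a q +ₚ shift (a ·ₚ (scale a p *ₚ scale a q))
      ≈⟨ +ₚ-congˡ (b ·ₚ scale a q) (shift-cong (*ₚ-·ₚˡ a (scale a p) (scale a q))) ⟨
    b ·ₚ scale a q +ₚ shift ((a ·ₚ scale a p) *ₚ scale a q)
      ∎
    where open ≋-Reasoning

  compose-·ₚX : ∀ a p → compose p (a ·ₚ X) ≋ scale a p
  compose-·ₚX a []      = ≋-refl
  compose-·ₚX a (b ∷ p) = begin
    const b +ₚ (a ·ₚ X) *ₚ compose p (a ·ₚ X)  ≈⟨ +ₚ-congˡ (const b) (*ₚ-·ₚˡ a X (compose p (a ·ₚ X))) ⟩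
    const b +ₚ a ·ₚ (X *ₚ compose p (a ·ₚ X))  ≈⟨ +ₚ-congˡ (const b) (·ₚ-congˡ a (≋-trans (X*ₚ _) (shift-cong (compose-·ₚX a p)))) ⟩
    const b +ₚ a ·ₚ shift (scale a p)           ≈⟨ +ₚ-congˡ (const b) (shift-·ₚ a (scale a p)) ⟨
    const b +ₚ shift (a ·ₚ scale a p)           ≈⟨ ∷-cong (+-identityʳ b) ≋-refl ⟩
    b ∷ a ·ₚ scale a p                         ∎
    where open ≋-Reasoning

  scale-degreeAtMost : ∀ a {p d} → DegreeAtMost p d → DegreeAtMost (scale a p) d
  scale-degreeAtMost a {p} p≤d i d<i = trans (coeff-scale a p i) (trans (*-congˡ (p≤d i d<i)) (zeroʳ _))

  shiftⁿ : ℕ → Pol → Pol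
  shiftⁿ zero    p = p
  shiftⁿ (suc k) p = shift (shiftⁿ k p)

  Xⁿ*ₚ : ∀ k p → X ^ₚ k *ₚ p ≋ shiftⁿ k p
  Xⁿ*ₚ zero    p = *ₚ-identityˡ p
  Xⁿ*ₚ (suc k) p = ≋-trans (*ₚ-assoc X (X ^ₚ k) p) (≋-trans (X*ₚ _) (shift-cong (Xⁿ*ₚ k p)))

  coeff-shiftⁿ-< : ∀ k p i → i < k → coeff (shiftⁿ k p) i ≈ 0#
  coeff-shiftⁿ-< (suc k) p zero    _           = refl
  coeff-shiftⁿ-< (suc k) p (suc i) (s≤s i<k) = coeff-shiftⁿ-< k p i i<k

  coeff-shiftⁿ-+ : ∀ k p i → coeff (shiftⁿ k p) (k ℕ.+ i) ≡ coeff p i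
  coeff-shiftⁿ-+ zero    p i = ≡.refl
  coeff-shiftⁿ-+ (suc k) p i = coeff-shiftⁿ-+ k p i

  inflate : ℕ → Pol → Pol
  inflate k p = compose p (X ^ₚ k)

  coeff-inflate-∷ : ∀ k a p i → coeff (inflate k (a ∷ p)) i ≈ coeff (const a) i + coeff (shiftⁿ k (inflate k p)) i
  coeff-inflate-∷ k a p i =
    trans (coeff-+ₚ (const a) (X ^ₚ k *ₚ inflate k p) i) (+-congˡ (≋⇒≈ₚ (Xⁿ*ₚ k (inflate k p)) i))

  coeff-inflate-* : ∀ k p i → coeff (inflate (suc k) p) (i ℕ.* suc k) ≈ coeff p i
  coeff-inflate-* k []      i       = refl
  coeff-inflate-* k (a ∷ p) zero    = trans (coeff-inflate-∷ (suc k) a p 0) (+-identityʳ a)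
  coeff-inflate-* k (a ∷ p) (suc i) = begin
    coeff (inflate (suc k) (a ∷ p)) (suc k ℕ.+ i ℕ.* suc k)
      ≈⟨ trans (coeff-inflate-∷ (suc k) a p _) (+-identityˡ _) ⟩
    coeff (shiftⁿ (suc k) (inflate (suc k) p)) (suc k ℕ.+ i ℕ.* suc k)
      ≡⟨ coeff-shiftⁿ-+ (suc k) _ (i ℕ.* suc k) ⟩
    coeff (inflate (suc k) p) (i ℕ.* suc k)
      ≈⟨ coeff-inflate-* k p i ⟩
    coeff p i
      ∎
    where open ≈-Reasoning

  coeff-inflate-+ : ∀ k p i r → 0 < r → r < suc k → coeff (inflate (suc k) p) (i ℕ.* suc k ℕ.+ r) ≈ 0#
  coeff-inflate-+ k []      i       r       _ _   = refl
  coeff-inflate-+ k (a ∷ p) zero    (suc r) _ r<k =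
    trans (coeff-inflate-∷ (suc k) a p (suc r)) (trans (+-identityˡ _) (coeff-shiftⁿ-< (suc k) (inflate (suc k) p) (suc r) r<k))
  coeff-inflate-+ k (a ∷ p) (suc i) r       0<r r<k = begin
    coeff (inflate (suc k) (a ∷ p)) (suc k ℕ.+ i ℕ.* suc k ℕ.+ r)
      ≡⟨ ≡.cong (coeff (inflate (suc k) (a ∷ p))) (ℕP.+-assoc (suc k) (i ℕ.* suc k) r) ⟩
    coeff (inflate (suc k) (a ∷ p)) (suc k ℕ.+ (i ℕ.* suc k ℕ.+ r))
      ≈⟨ trans (coeff-inflate-∷ (suc k) a p _) (+-identityˡ _) ⟩
    coeff (shiftⁿ (suc k) (inflate (suc k) p)) (suc k ℕ.+ (i ℕ.* suc k ℕ.+ r))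
      ≡⟨ coeff-shiftⁿ-+ (suc k) (inflate (suc k) p) (i ℕ.* suc k ℕ.+ r) ⟩
    coeff (inflate (suc k) p) (i ℕ.* suc k ℕ.+ r)
      ≈⟨ coeff-inflate-+ k p i r 0<r r<k ⟩
    0#
      ∎
    where open ≈-Reasoning

  coeff-inflate-∤ : ∀ k p l → ¬ (suc k ∣ l) → coeff (inflate (suc k) p) l ≈ 0#
  coeff-inflate-∤ k p l k∤l with l % suc k in l%k≡r
  ... | zero  = ⊥-elim (k∤l (ℕD.m%n≡0⇒n∣m l (suc k) l%k≡r))
  ... | suc r = ≡.subst (λ i → coeff (inflate (suc k) p) i ≈ 0#) (≡.sym l≡)
                  (coeff-inflate-+ k p (l / suc k) (suc r) (s≤s z≤n) (≡.subst (_< suc k) l%k≡r (m%n<n l (suc k))))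
    where
    l≡ : l ≡ l / suc k ℕ.* suc k ℕ.+ suc r
    l≡ = ≡.trans (m≡m%n+[m/n]*n l (suc k))
                 (≡.trans (ℕP.+-comm (l % suc k) (l / suc k ℕ.* suc k)) (≡.cong (l / suc k ℕ.* suc k ℕ.+_) l%k≡r))

  inflate-monic : ∀ k {p d} → MonicOfDegree p d → MonicOfDegree (inflate (suc k) p) (d ℕ.* suc k)
  inflate-monic k {p} {d} (p-lead , p≤d) = trans (coeff-inflate-* k p d) p-lead , above
    where
    above : DegreeAtMost (inflate (suc k) p) (d ℕ.* suc k)
    above l dk<l with suc k ℕD.∣? l
    ... | no  k∤l                 = coeff-inflate-∤ k p l k∤l
    ... | yes (divides q ≡.refl) = trans (coeff-inflate-* k p q) (p≤d q (ℕP.*-cancelʳ-< (suc k) d q dk<l))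

  SupportedOnMultiples : ℕ → Pol → Set ℓ
  SupportedOnMultiples m p = ∀ l → ¬ (coeff p l ≈ 0#) → m ∣ l

  supportedOnMultiples-cong : ∀ {m p q} → p ≋ q → SupportedOnMultiples m p → SupportedOnMultiples m q
  supportedOnMultiples-cong p≋q p∈ l q[l]≉0 = p∈ l (λ p[l]≈0 → q[l]≉0 (trans (sym (≋⇒≈ₚ p≋q l)) p[l]≈0))

  inflate-supportedOnMultiples : ∀ {m} → 0 < m → ∀ p → SupportedOnMultiples m (inflate m p)
  inflate-supportedOnMultiples {suc k} _ p l p[l]≉0 with suc k ℕD.∣? l
  ... | yes k∣l = k∣l
  ... | no  k∤l = ⊥-elim (p[l]≉0 (coeff-inflate-∤ k p l k∤l))

  scale≋·ₚ⇒^ᶠ≈ : ∀ {a b p} → scale a p ≋ b ·ₚ p → ∀ {l} → ¬ (coeff p l ≈ 0#) → a ^ᶠ l ≈ b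
  scale≋·ₚ⇒^ᶠ≈ {a} {b} {p} ap≋bp {l} p[l]≉0 =
    *-cancelʳ p[l]≉0 (trans (sym (coeff-scale a p l)) (trans (≋⇒≈ₚ ap≋bp l) (coeff-·ₚ b p l)))

  tabulate : (ℕ → Carrier) → ℕ → Pol
  tabulate g zero    = []
  tabulate g (suc N) = g 0 ∷ tabulate (λ i → g (suc i)) N

  coeff-tabulate-< : ∀ g N i → i < N → coeff (tabulate g N) i ≡ g i
  coeff-tabulate-< g (suc N) zero    _         = ≡.refl
  coeff-tabulate-< g (suc N) (suc i) (s≤s i<N) = coeff-tabulate-< (λ i → g (suc i)) N i i<N

  coeff-tabulate-≥ : ∀ g N i → N ≤ i → coeff (tabulate g N) i ≡ 0#
  coeff-tabulate-≥ g zero    i       _         = ≡.refl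
  coeff-tabulate-≥ g (suc N) (suc i) (s≤s N≤i) = coeff-tabulate-≥ (λ i → g (suc i)) N i N≤i

  deflate : ℕ → ℕ → Pol → Pol
  deflate k N p = tabulate (λ i → coeff p (i ℕ.* suc k)) (suc N)

  deflate-monic : ∀ k u p → MonicOfDegree p (u ℕ.* suc k) → MonicOfDegree (deflate k (u ℕ.* suc k) p) u
  deflate-monic k u p (p-lead , p≤uk) = lead , above
    where
    g = λ i → coeff p (i ℕ.* suc k)
    lead : coeff (deflate k (u ℕ.* suc k) p) u ≈ 1#
    lead = ≡.subst (_≈ 1#) (≡.sym (coeff-tabulate-< g _ u (s≤s (ℕP.m≤m*n u (suc k))))) p-lead
    above : DegreeAtMost (deflate k (u ℕ.* suc k) p) u
    above i u<i with ℕP.<-≤-connex i (suc (u ℕ.* suc k))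
    ... | inj₁ i≤uk = ≡.subst (_≈ 0#) (≡.sym (coeff-tabulate-< g _ i i≤uk)) (p≤uk _ (ℕP.*-monoˡ-< (suc k) u<i))
    ... | inj₂ uk<i = ≡.subst (_≈ 0#) (≡.sym (coeff-tabulate-≥ g _ i uk<i)) refl

  module WithDecidableEquality (_≟_ : ∀ x y → Dec (x ≈ y)) where

    ≋-inflate-deflate : ∀ k N p → DegreeAtMost p N → SupportedOnMultiples (suc k) p →
                        p ≋ inflate (suc k) (deflate k N p)
    ≋-inflate-deflate k N p p≤N p∈ = mk≋ λ l → at l (suc k ℕD.∣? l)
      where
      g = λ i → coeff p (i ℕ.* suc k)
      q = deflate k N p
      at : ∀ l → Dec (suc k ∣ l) → coeff p l ≈ coeff (inflate (suc k) q) l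
      at l (no k∤l) with coeff p l ≟ 0#
      ... | yes p[l]≈0 = trans p[l]≈0 (sym (coeff-inflate-∤ k q l k∤l))
      ... | no  p[l]≉0 = ⊥-elim (k∤l (p∈ l p[l]≉0))
      at l (yes (divides i ≡.refl)) with ℕP.<-≤-connex i (suc N)
      ... | inj₁ i≤N = sym (trans (coeff-inflate-* k q i)
                                  (≡.subst (_≈ coeff p (i ℕ.* suc k)) (≡.sym (coeff-tabulate-< g (suc N) i i≤N)) refl))
      ... | inj₂ N<i = trans (p≤N (i ℕ.* suc k) (ℕP.<-≤-trans N<i (ℕP.m≤m*n i (suc k))))
                             (sym (trans (coeff-inflate-* k q i)
                                         (≡.subst (_≈ 0#) (≡.sym (coeff-tabulate-≥ g (suc N) i N<i)) refl)))

module Evaluation {c ℓ c′ ℓ′} (K : Field c ℓ) (L : Field c′ ℓ′)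
                  (ι : Field.Carrier K → Field.Carrier L) (ι-hom : IsFieldHom K L ι) where
  private
    module K = Field K
    module KP = Poly K
  open Field L hiding (zero)
  open Poly L using (eval; _^ᶠ_)
  open PolynomialRing K using (_≋_; ≋-sym; shift; ∷-≋[]⁻¹; ∷-injective)
  open Substitution K using (scale; inflate)
  open RingMorphisms.IsRingHomomorphism ι-hom public
    using () renaming (0#-homo to ι-0; 1#-homo to ι-1; +-homo to ι-+; *-homo to ι-*; ⟦⟧-cong to ι-cong)
  private module ≈-Reasoning = SetoidReasoning setoid
  open import Algebra.Properties.CommutativeSemigroup +-commutativeSemigroup using (interchange)
  open import Algebra.Properties.CommutativeSemigroup *-commutativeSemigroup using (x∙yz≈y∙xz)

  ⟦_⟧ : KP.Pol → Carrier → Carrier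
  ⟦ p ⟧ x = eval (mapPol K L ι p) x

  ι-^ᶠ : ∀ a n → ι (a KP.^ᶠ n) ≈ ι a ^ᶠ n
  ι-^ᶠ a zero    = ι-1
  ι-^ᶠ a (suc n) = trans (ι-* _ _) (*-congˡ (ι-^ᶠ a n))

  ι-≉0 : ∀ {a} → ¬ (a K.≈ K.0#) → ¬ (ι a ≈ 0#)
  ι-≉0 {a} a≉0 ιa≈0 = 1≉0 (begin
    1#                   ≈⟨ ι-1 ⟨
    ι K.1#               ≈⟨ ι-cong (K.⁻¹-inverse a a≉0) ⟨
    ι (a K.* a K.⁻¹)     ≈⟨ ι-* _ _ ⟩
    ι a * ι (a K.⁻¹)     ≈⟨ *-congʳ ιa≈0 ⟩
    0# * ι (a K.⁻¹)      ≈⟨ zeroˡ _ ⟩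
    0#                   ∎)
    where open ≈-Reasoning

  ⟦⟧-≋[] : ∀ {p} x → p ≋ [] → ⟦ p ⟧ x ≈ 0#
  ⟦⟧-≋[] {[]}    x _    = refl
  ⟦⟧-≋[] {a ∷ p} x p≋[] with ∷-≋[]⁻¹ p≋[]
  ... | a≈0 , p≋[]′ = trans (+-cong (trans (ι-cong a≈0) ι-0) (*-congˡ (⟦⟧-≋[] x p≋[]′)))
                            (trans (+-identityˡ _) (zeroʳ x))

  ⟦⟧-cong : ∀ {p q} x → p ≋ q → ⟦ p ⟧ x ≈ ⟦ q ⟧ x
  ⟦⟧-cong {[]}    {q}     x p≋q = sym (⟦⟧-≋[] x (≋-sym p≋q))
  ⟦⟧-cong {a ∷ p} {[]}    x p≋q = ⟦⟧-≋[] x p≋q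
  ⟦⟧-cong {a ∷ p} {b ∷ q} x p≋q with ∷-injective p≋q
  ... | a≈b , p≋q′ = +-cong (ι-cong a≈b) (*-congˡ (⟦⟧-cong x p≋q′))

  ⟦⟧-congʳ : ∀ p {x y} → x ≈ y → ⟦ p ⟧ x ≈ ⟦ p ⟧ y
  ⟦⟧-congʳ []      x≈y = refl
  ⟦⟧-congʳ (a ∷ p) x≈y = +-congˡ (*-cong x≈y (⟦⟧-congʳ p x≈y))

  ⟦⟧-+ₚ : ∀ p q x → ⟦ p KP.+ₚ q ⟧ x ≈ ⟦ p ⟧ x + ⟦ q ⟧ x
  ⟦⟧-+ₚ []      q       x = sym (+-identityˡ _)
  ⟦⟧-+ₚ (a ∷ p) []      x = sym (+-identityʳ _)
  ⟦⟧-+ₚ (a ∷ p) (b ∷ q) x = begin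
    ι (a K.+ b) + x * ⟦ p KP.+ₚ q ⟧ x            ≈⟨ +-cong (ι-+ a b) (*-congˡ (⟦⟧-+ₚ p q x)) ⟩
    (ι a + ι b) + x * (⟦ p ⟧ x + ⟦ q ⟧ x)        ≈⟨ +-congˡ (distribˡ x _ _) ⟩
    (ι a + ι b) + (x * ⟦ p ⟧ x + x * ⟦ q ⟧ x)    ≈⟨ interchange _ _ _ _ ⟩
    (ι a + x * ⟦ p ⟧ x) + (ι b + x * ⟦ q ⟧ x)    ∎
    where open ≈-Reasoning

  ⟦⟧-·ₚ : ∀ a p x → ⟦ a KP.·ₚ p ⟧ x ≈ ι a * ⟦ p ⟧ x
  ⟦⟧-·ₚ a []      x = sym (zeroʳ _)
  ⟦⟧-·ₚ a (b ∷ p) x = begin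
    ι (a K.* b) + x * ⟦ a KP.·ₚ p ⟧ x      ≈⟨ +-cong (ι-* a b) (*-congˡ (⟦⟧-·ₚ a p x)) ⟩
    ι a * ι b + x * (ι a * ⟦ p ⟧ x)        ≈⟨ +-congˡ (x∙yz≈y∙xz x (ι a) _) ⟩
    ι a * ι b + ι a * (x * ⟦ p ⟧ x)        ≈⟨ distribˡ (ι a) _ _ ⟨
    ι a * (ι b + x * ⟦ p ⟧ x)              ∎
    where open ≈-Reasoning

  ⟦⟧-shift : ∀ p x → ⟦ shift p ⟧ x ≈ x * ⟦ p ⟧ x
  ⟦⟧-shift p x = trans (+-congʳ ι-0) (+-identityˡ _)

  ⟦⟧-*ₚ : ∀ p q x → ⟦ p KP.*ₚ q ⟧ x ≈ ⟦ p ⟧ x * ⟦ q ⟧ x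
  ⟦⟧-*ₚ []      q x = sym (zeroˡ _)
  ⟦⟧-*ₚ (a ∷ p) q x = begin
    ⟦ a KP.·ₚ q KP.+ₚ shift (p KP.*ₚ q) ⟧ x    ≈⟨ ⟦⟧-+ₚ (a KP.·ₚ q) (shift (p KP.*ₚ q)) x ⟩
    ⟦ a KP.·ₚ q ⟧ x + ⟦ shift (p KP.*ₚ q) ⟧ x  ≈⟨ +-cong (⟦⟧-·ₚ a q x) (trans (⟦⟧-shift (p KP.*ₚ q) x) (*-congˡ (⟦⟧-*ₚ p q x))) ⟩
    ι a * ⟦ q ⟧ x + x * (⟦ p ⟧ x * ⟦ q ⟧ x)   ≈⟨ +-congˡ (*-assoc x _ _) ⟨
    ι a * ⟦ q ⟧ x + (x * ⟦ p ⟧ x) * ⟦ q ⟧ x   ≈⟨ distribʳ _ _ _ ⟨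
    (ι a + x * ⟦ p ⟧ x) * ⟦ q ⟧ x             ∎
    where open ≈-Reasoning

  ⟦⟧-const : ∀ a x → ⟦ KP.const a ⟧ x ≈ ι a
  ⟦⟧-const a x = trans (+-congˡ (zeroʳ x)) (+-identityʳ _)

  ⟦⟧-compose : ∀ p g x → ⟦ KP.compose p g ⟧ x ≈ ⟦ p ⟧ (⟦ g ⟧ x)
  ⟦⟧-compose []      g x = refl
  ⟦⟧-compose (a ∷ p) g x = begin
    ⟦ KP.const a KP.+ₚ g KP.*ₚ KP.compose p g ⟧ x      ≈⟨ ⟦⟧-+ₚ (KP.const a) (g KP.*ₚ KP.compose p g) x ⟩
    ⟦ KP.const a ⟧ x + ⟦ g KP.*ₚ KP.compose p g ⟧ x    ≈⟨ +-cong (⟦⟧-const a x) (trans (⟦⟧-*ₚ g (KP.compose p g) x) (*-congˡ (⟦⟧-compose p g x))) ⟩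
    ι a + ⟦ g ⟧ x * ⟦ p ⟧ (⟦ g ⟧ x)                  ∎
    where open ≈-Reasoning

  ⟦⟧-X : ∀ x → ⟦ KP.X ⟧ x ≈ x
  ⟦⟧-X x = trans (+-cong ι-0 (*-congˡ (⟦⟧-const K.1# x))) (trans (+-identityˡ _) (trans (*-congˡ ι-1) (*-identityʳ x)))

  ⟦⟧-Xⁿ : ∀ k x → ⟦ KP.X KP.^ₚ k ⟧ x ≈ x ^ᶠ k
  ⟦⟧-Xⁿ zero    x = trans (⟦⟧-const K.1# x) ι-1
  ⟦⟧-Xⁿ (suc k) x = trans (⟦⟧-*ₚ KP.X (KP.X KP.^ₚ k) x) (*-cong (⟦⟧-X x) (⟦⟧-Xⁿ k x))

  ⟦⟧-inflate : ∀ k p x → ⟦ inflate k p ⟧ x ≈ ⟦ p ⟧ (x ^ᶠ k)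
  ⟦⟧-inflate k p x = trans (⟦⟧-compose p (KP.X KP.^ₚ k) x) (⟦⟧-congʳ p (⟦⟧-Xⁿ k x))

  ⟦⟧-scale : ∀ a p x → ⟦ scale a p ⟧ x ≈ ⟦ p ⟧ (ι a * x)
  ⟦⟧-scale a []      x = refl
  ⟦⟧-scale a (b ∷ p) x = +-congˡ (begin
    x * ⟦ a KP.·ₚ scale a p ⟧ x          ≈⟨ *-congˡ (trans (⟦⟧-·ₚ a (scale a p) x) (*-congˡ (⟦⟧-scale a p x))) ⟩
    x * (ι a * ⟦ p ⟧ (ι a * x))          ≈⟨ *-assoc x (ι a) _ ⟨
    (x * ι a) * ⟦ p ⟧ (ι a * x)          ≈⟨ *-congʳ (*-comm x (ι a)) ⟩
    (ι a * x) * ⟦ p ⟧ (ι a * x)          ∎)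
    where open ≈-Reasoning

  ⟦⟧-divisor-root : ∀ {g} q d r {x} → g ≋ q KP.*ₚ d KP.+ₚ r → ⟦ d ⟧ x ≈ 0# → ⟦ g ⟧ x ≈ ⟦ r ⟧ x
  ⟦⟧-divisor-root {g} q d r {x} g≋qd+r d[x]≈0 = begin
    ⟦ g ⟧ x                      ≈⟨ ⟦⟧-cong x g≋qd+r ⟩
    ⟦ q KP.*ₚ d KP.+ₚ r ⟧ x      ≈⟨ ⟦⟧-+ₚ (q KP.*ₚ d) r x ⟩
    ⟦ q KP.*ₚ d ⟧ x + ⟦ r ⟧ x    ≈⟨ +-congʳ (trans (⟦⟧-*ₚ q d x) (trans (*-congˡ d[x]≈0) (zeroʳ _))) ⟩
    0# + ⟦ r ⟧ x                 ≈⟨ +-identityˡ _ ⟩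
    ⟦ r ⟧ x                      ∎
    where open ≈-Reasoning

  ⟦⟧-prod1-root : ∀ r h {x} → 0 < r → ⟦ h r ⟧ x ≈ 0# → ⟦ KP.prod1 r h ⟧ x ≈ 0#
  ⟦⟧-prod1-root (suc r) h {x} _ h[x]≈0 =
    trans (⟦⟧-*ₚ (KP.prod1 r h) (h (suc r)) x) (trans (*-congˡ h[x]≈0) (zeroʳ _))

module Coarsening (i s t : ℕ) (0<i : 0 < i) (i<s : i < s) where
  private instance
    gcd≢0 : NonZero (gcd i s)
    gcd≢0 = ℕ.≢-nonZero (gcd[m,n]≢0 i s (inj₁ (ℕP.>⇒≢ 0<i)))

  s/gcd : ℕ
  s/gcd = ℕD.quotient (gcd[m,n]∣n i s)

  coarsening : ℕ
  coarsening = s/gcd ℕ.* t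

  private
    s≡s/gcd*gcd : s ≡ s/gcd ℕ.* gcd i s
    s≡s/gcd*gcd = ℕD.m∣n⇒n≡quotient*m (gcd[m,n]∣n i s)

    s*t≡gcd*coarsening : s ℕ.* t ≡ gcd i s ℕ.* coarsening
    s*t≡gcd*coarsening = begin
      s ℕ.* t                     ≡⟨ ≡.cong (ℕ._* t) s≡s/gcd*gcd ⟩
      s/gcd ℕ.* gcd i s ℕ.* t     ≡⟨ ≡.cong (ℕ._* t) (ℕP.*-comm s/gcd (gcd i s)) ⟩
      gcd i s ℕ.* s/gcd ℕ.* t     ≡⟨ ℕP.*-assoc (gcd i s) s/gcd t ⟩
      gcd i s ℕ.* coarsening      ∎
      where open ≡.≡-Reasoning

  1<s/gcd : 1 < s/gcd
  1<s/gcd with ℕP.<-≤-connex 1 s/gcd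
  ... | inj₁ 1<q = 1<q
  ... | inj₂ q≤1 = ⊥-elim (ℕP.<⇒≱ i<s (begin
    s                    ≡⟨ s≡s/gcd*gcd ⟩
    s/gcd ℕ.* gcd i s    ≤⟨ ℕP.*-monoˡ-≤ (gcd i s) q≤1 ⟩
    1 ℕ.* gcd i s        ≡⟨ ℕP.*-identityˡ (gcd i s) ⟩
    gcd i s              ≤⟨ ℕD.∣⇒≤ {{ℕ.>-nonZero 0<i}} (gcd[m,n]∣m i s) ⟩
    i                    ∎))
    where open ℕP.≤-Reasoning

  t<coarsening : 0 < t → t < coarsening
  t<coarsening 0<t = ≡.subst (_< coarsening) (ℕP.*-identityˡ t) (ℕP.*-monoˡ-< t {{ℕ.>-nonZero 0<t}} 1<s/gcd)

  coarsening∣s*t : coarsening ∣ s ℕ.* t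
  coarsening∣s*t = ≡.subst (coarsening ∣_) (≡.sym s*t≡gcd*coarsening) (ℕD.n∣m*n (gcd i s))

  coarsening∣ : ∀ l → s ℕ.* t ∣ i ℕ.* l → t ∣ l → coarsening ∣ l
  coarsening∣ l st∣il t∣l = ℕD.*-cancelˡ-∣ (gcd i s) (≡.subst₂ _∣_ s*t≡gcd*coarsening gcd[li,ls]≡gcd*l st∣gcd)
    where
    st∣gcd : s ℕ.* t ∣ gcd (l ℕ.* i) (l ℕ.* s)
    st∣gcd = gcd-greatest (≡.subst (s ℕ.* t ∣_) (ℕP.*-comm i l) st∣il)
                          (≡.subst (s ℕ.* t ∣_) (ℕP.*-comm s l) (ℕD.*-monoʳ-∣ s t∣l))
    gcd[li,ls]≡gcd*l : gcd (l ℕ.* i) (l ℕ.* s) ≡ gcd i s ℕ.* l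
    gcd[li,ls]≡gcd*l = ≡.trans (≡.sym (c*gcd[m,n]≡gcd[cm,cn] l i s)) (ℕP.*-comm l (gcd i s))

module PrimitiveRoot {c ℓ} (F : Field c ℓ) (k : ℕ) where
  open Field F hiding (zero)
  open Poly F
  open FieldProperties F
  private module ≈-Reasoning = SetoidReasoning setoid

  module _ {ω : Carrier} (ω-prim : IsPrimitiveRoot (suc k) ω) where

    ω≉0 : ¬ (ω ≈ 0#)
    ω≉0 ω≈0 = 1≉0 (trans (sym (proj₁ ω-prim)) (trans (*-congʳ ω≈0) (zeroˡ _)))

    ω^[a*k]≈1 : ∀ a → ω ^ᶠ (a ℕ.* suc k) ≈ 1#
    ω^[a*k]≈1 a = begin
      ω ^ᶠ (a ℕ.* suc k)     ≡⟨ ≡.cong (ω ^ᶠ_) (ℕP.*-comm a (suc k)) ⟩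
      ω ^ᶠ (suc k ℕ.* a)     ≈⟨ ^ᶠ-assocʳ ω (suc k) a ⟨
      (ω ^ᶠ suc k) ^ᶠ a      ≈⟨ ^ᶠ-congˡ a (proj₁ ω-prim) ⟩
      1# ^ᶠ a                ≈⟨ 1^ᶠn≈1 a ⟩
      1#                     ∎
      where open ≈-Reasoning

    ω^l≈1⇒k∣l : ∀ l → ω ^ᶠ l ≈ 1# → suc k ∣ l
    ω^l≈1⇒k∣l l ω^l≈1 with l % suc k in l%k≡r
    ... | zero  = ℕD.m%n≡0⇒n∣m l (suc k) l%k≡r
    ... | suc r = ⊥-elim (proj₂ ω-prim (suc r) (s≤s z≤n) (≡.subst (_< suc k) l%k≡r (m%n<n l (suc k))) ω^r≈1)
      where
      open ≈-Reasoning
      ω^r≈1 : ω ^ᶠ suc r ≈ 1#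
      ω^r≈1 = begin
        ω ^ᶠ suc r                                 ≈⟨ *-identityʳ _ ⟨
        ω ^ᶠ suc r * 1#                            ≈⟨ *-congˡ (ω^[a*k]≈1 (l / suc k)) ⟨
        ω ^ᶠ suc r * ω ^ᶠ (l / suc k ℕ.* suc k)    ≈⟨ ^ᶠ-homo-* ω (suc r) _ ⟨
        ω ^ᶠ (suc r ℕ.+ l / suc k ℕ.* suc k)       ≡⟨ ≡.cong (λ e → ω ^ᶠ (e ℕ.+ l / suc k ℕ.* suc k)) l%k≡r ⟨
        ω ^ᶠ (l % suc k ℕ.+ l / suc k ℕ.* suc k)   ≡⟨ ≡.cong (ω ^ᶠ_) (m≡m%n+[m/n]*n l (suc k)) ⟨
        ω ^ᶠ l                                     ≈⟨ ω^l≈1 ⟩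
        1#                                         ∎

  ⁻¹-isPrimitiveRoot : ∀ {ζ} → IsPrimitiveRoot (suc k) ζ → IsPrimitiveRoot (suc k) (ζ ⁻¹)
  ⁻¹-isPrimitiveRoot {ζ} ζ-prim =
      x*y≈1∧y≈1⇒x≈1 (trans (*-comm _ _) (ζ^n*ζ⁻¹^n≈1 (suc k))) (proj₁ ζ-prim)
    , λ j 0<j j<k ζ⁻¹^j≈1 → proj₂ ζ-prim j 0<j j<k (x*y≈1∧y≈1⇒x≈1 (ζ^n*ζ⁻¹^n≈1 j) ζ⁻¹^j≈1)
    where
    ζ^n*ζ⁻¹^n≈1 : ∀ n → ζ ^ᶠ n * (ζ ⁻¹) ^ᶠ n ≈ 1#
    ζ^n*ζ⁻¹^n≈1 n = x^ᶠn*x⁻¹^ᶠn≈1 n (ω≉0 ζ-prim)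

module Irreducibility {c ℓ} (F : Field c ℓ) where
  open Field F hiding (zero)
  open Poly F
  open PolynomialRing F
  open PolynomialDegree F
  private module ≈-Reasoning = SetoidReasoning setoid

  irreducible-no-monic-factor : ∀ {f n g e} q → MonicOfDegree f n → Irreducible f →
                                MonicOfDegree g e → 0 < e → e < n → ¬ (f ≋ q *ₚ g)
  irreducible-no-monic-factor {f} {n} {g} {e} q (f-lead , _) (_ , f-irr) (g-lead , g≤e) 0<e e<n f≋qg
    with f-irr q g (≋⇒≈ₚ f≋qg)
  ... | inj₂ g-const = 1≉0 (trans (sym g-lead) (g-const e 0<e))
  ... | inj₁ q-const = 1≉0 (begin
    1#                         ≈⟨ f-lead ⟨
    coeff f n                  ≈⟨ ≋⇒≈ₚ f≋qg n ⟩
    coeff (q *ₚ g) n           ≈⟨ ≋⇒≈ₚ (≋-trans (*ₚ-congʳ g (degreeAtMost0⇒≋const q q-const)) (const-*ₚ _ g)) n ⟩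
    coeff (coeff q 0 ·ₚ g) n   ≈⟨ coeff-·ₚ _ g n ⟩
    coeff q 0 * coeff g n      ≈⟨ *-congˡ (g≤e n e<n) ⟩
    coeff q 0 * 0#             ≈⟨ zeroʳ _ ⟩
    0#                         ∎)
    where open ≈-Reasoning

  X-monic : MonicOfDegree X 1
  X-monic = refl , λ { (suc (suc i)) _ → refl ; (suc zero) (s≤s ()) }

  irreducible-coeff0≉0 : ∀ {f n} → MonicOfDegree f n → Irreducible f → ¬ (f ≈ₚ X) → ¬ (coeff f 0 ≈ 0#)
  irreducible-coeff0≉0 {[]}    (f-lead , _) _ _ _ = 1≉0 (sym f-lead)
  irreducible-coeff0≉0 {a ∷ p} {zero} (f-lead , _) _ _ a≈0 = 1≉0 (trans (sym f-lead) a≈0)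
  irreducible-coeff0≉0 {a ∷ p} {suc zero} (f-lead , f≤1) _ f≉X a≈0 = f≉X λ
    { zero          → a≈0
    ; (suc zero)    → f-lead
    ; (suc (suc i)) → f≤1 (suc (suc i)) (s≤s (s≤s z≤n)) }
  irreducible-coeff0≉0 {a ∷ p} {suc (suc n)} f-monic f-irr _ a≈0 =
    irreducible-no-monic-factor p f-monic f-irr X-monic (s≤s z≤n) (s≤s (s≤s z≤n)) f≋pX
    where
    f≋pX : a ∷ p ≋ p *ₚ X
    f≋pX = ≋-trans (∷-cong a≈0 ≋-refl) (≋-trans (≋-sym (X*ₚ p)) (*ₚ-comm X p))

module RootOfIrreducible
    {c ℓ c′ ℓ′} (K : Field c ℓ) (L : Field c′ ℓ′)
    (ι : Field.Carrier K → Field.Carrier L) (ι-hom : IsFieldHom K L ι)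
    (_≟_ : ∀ x y → Dec (Field._≈_ K x y))
    {f : Poly.Pol K} {n : ℕ} (f-monic : Poly.MonicOfDegree K f n) (f-irr : Poly.Irreducible K f)
    {β : Field.Carrier L} (f[β]≈0 : IsRootOf K L ι β f) where
  open Field K hiding (zero)
  open Poly K
  open PolynomialRing K
  open PolynomialDegree K
  open WithDecidableEquality _≟_
  open FieldProperties K using (x⁻¹*x≈1)
  open Irreducibility K using (irreducible-no-monic-factor)
  open Evaluation K L ι ι-hom
  private module L = Field L

  no-root-of-smaller-degree : ∀ e → e < n → ∀ r → HasDegree r e → ¬ (⟦ r ⟧ β L.≈ L.0#)
  no-root-of-smaller-degree = <-rec _ λ
    { zero    _   _   r (r[0]≉0 , r≤0) r[β]≈0 →
        ι-≉0 r[0]≉0 (L.trans (L.sym (L.trans (⟦⟧-cong β (degreeAtMost0⇒≋const r r≤0)) (⟦⟧-const _ β))) r[β]≈0)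
    ; (suc e) rec e<n r r-deg r[β]≈0 → descend e rec e<n r r-deg r[β]≈0 }
    where
    -- Dividing f by r, made monic, leaves a remainder of smaller degree that still vanishes at β.
    descend : ∀ e → (∀ {d} → d < suc e → d < n → ∀ r → HasDegree r d → ¬ (⟦ r ⟧ β L.≈ L.0#)) →
              suc e < n → ∀ r → HasDegree r (suc e) → ¬ (⟦ r ⟧ β L.≈ L.0#)
    descend e rec e<n r (lead≉0 , r≤e) r[β]≈0 = from-division (divMonic {r̃} r̃-monic f)
      where
      r̃ = (coeff r (suc e) ⁻¹) ·ₚ r
      r̃-monic : MonicOfDegree r̃ (suc e)
      r̃-monic = trans (coeff-·ₚ _ r (suc e)) (x⁻¹*x≈1 _ lead≉0)
              , ·ₚ-degreeAtMost _ {r} r≤e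
      r̃[β]≈0 : ⟦ r̃ ⟧ β L.≈ L.0#
      r̃[β]≈0 = L.trans (⟦⟧-·ₚ _ r β) (L.trans (L.*-congˡ r[β]≈0) (L.zeroʳ _))
      from-division : Division f r̃ (suc e) → ⊥
      from-division (division q R f≋qr̃+R R<e) with degreeBelow-cases {R} R<e
      ... | inj₁ R≋[] =
        irreducible-no-monic-factor q f-monic f-irr r̃-monic (s≤s z≤n) e<n (≋-trans f≋qr̃+R (+ₚ-identityʳ _ R≋[]))
      ... | inj₂ (d , R-deg , d<e) =
        rec d<e (ℕP.<-trans d<e e<n) R R-deg (L.trans (L.sym (⟦⟧-divisor-root q r̃ R f≋qr̃+R r̃[β]≈0)) f[β]≈0)

  root⇒f∣ : ∀ g → ⟦ g ⟧ β L.≈ L.0# → f ∣ₚ g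
  root⇒f∣ g g[β]≈0 with divMonic f-monic g
  ... | division q R g≋qf+R R<n with degreeBelow-cases {R} R<n
  ...   | inj₁ R≋[] = q , ≋-trans g≋qf+R (≋-trans (+ₚ-identityʳ _ R≋[]) (*ₚ-comm q f))
  ...   | inj₂ (d , R-deg , d<n) =
    ⊥-elim (no-root-of-smaller-degree d d<n R R-deg (L.trans (L.sym (⟦⟧-divisor-root q f R g≋qf+R f[β]≈0)) g[β]≈0))

module MinimalPolynomialOfPower
    {c ℓ c′ ℓ′} (K : Field c ℓ) (L : Field c′ ℓ′)
    (ι : Field.Carrier K → Field.Carrier L) (ι-hom : IsFieldHom K L ι)
    (_≟_ : ∀ x y → Dec (Field._≈_ K x y))
    (k′ : ℕ) {ζ : Field.Carrier K} (ζ-prim : Poly.IsPrimitiveRoot K (suc k′) ζ)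
    {f : Poly.Pol K} {n : ℕ} (f≉X : ¬ (Poly._≈ₚ_ K f (Poly.X K)))
    (f-monic : Poly.MonicOfDegree K f n) (f-irr : Poly.Irreducible K f)
    {β : Field.Carrier L} (f[β]≈0 : IsRootOf K L ι β f)
    {t s : ℕ} (t-max : Poly.IsMaxCompression K f n (suc k′) t) (k≡s*t : suc k′ ≡ s ℕ.* t) where
  open Field K hiding (zero)
  open Poly K
  open PolynomialRing K
  open PolynomialDegree K
  open PolynomialDegree.WithDecidableEquality K _≟_
  open FieldProperties K
  open Substitution K
  open Substitution.WithDecidableEquality K _≟_
  open Evaluation K L ι ι-hom
  open RootOfIrreducible K L ι ι-hom _≟_ {f} {n} f-monic f-irr {β} f[β]≈0
  open PrimitiveRoot K k′
  open Irreducibility K using (irreducible-coeff0≉0)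
  private
    module L  = Field L
    module LP = Poly L
    module LF = FieldProperties L
    module ≈-Reasoning = SetoidReasoning setoid
    module L-Reasoning = SetoidReasoning L.setoid

  k : ℕ
  k = suc k′

  ξ : Carrier
  ξ = ζ ⁻¹

  ξ-prim : IsPrimitiveRoot k ξ
  ξ-prim = ⁻¹-isPrimitiveRoot ζ-prim

  ζʲ*ξʲ≈1 : ∀ j → ζ ^ᶠ j * ξ ^ᶠ j ≈ 1#
  ζʲ*ξʲ≈1 j = x^ᶠn*x⁻¹^ᶠn≈1 j (ω≉0 ζ-prim)

  f-lead≉0 : ¬ (coeff f n ≈ 0#)
  f-lead≉0 = proj₁ (monic⇒hasDegree {f} f-monic)

  0<t : 0 < t
  0<t = ℕP.n≢0⇒n>0 λ t≡0 →
    gcd[m,n]≢0 n k (inj₂ λ ()) (ℕD.0∣⇒≡0 (≡.subst (_∣ gcd n k) t≡0 (proj₁ (proj₁ t-max))))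

  0<s : 0 < s
  0<s = ℕP.n≢0⇒n>0 λ s≡0 → ℕP.0≢1+n (≡.sym (≡.trans k≡s*t (≡.cong (ℕ._* t) s≡0)))

  f-supported : SupportedOnMultiples t f
  f-supported with proj₂ (proj₁ t-max)
  ... | g , f≈g[Xᵗ] =
    supportedOnMultiples-cong {p = inflate t g} {q = f} (≋-sym (mk≋ f≈g[Xᵗ])) (inflate-supportedOnMultiples 0<t g)

  ω^[s*l]≈1 : ∀ {ω} → IsPrimitiveRoot k ω → ∀ {l} → t ∣ l → ω ^ᶠ (s ℕ.* l) ≈ 1#
  ω^[s*l]≈1 {ω} ω-prim (divides a ≡.refl) =
    trans (reflexive (≡.cong (ω ^ᶠ_) s*[a*t]≡a*k)) (ω^[a*k]≈1 ω-prim a)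
    where
    open import Algebra.Properties.CommutativeSemigroup ℕP.*-commutativeSemigroup using (x∙yz≈y∙xz)
    s*[a*t]≡a*k : s ℕ.* (a ℕ.* t) ≡ a ℕ.* k
    s*[a*t]≡a*k = ≡.trans (x∙yz≈y∙xz s a t) (≡.cong (a ℕ.*_) (≡.sym k≡s*t))

  scale-ζˢ-f : scale (ζ ^ᶠ s) f ≋ f
  scale-ζˢ-f = mk≋ λ l → trans (coeff-scale (ζ ^ᶠ s) f l) (fixed l (coeff f l ≟ 0#))
    where
    fixed : ∀ l → Dec (coeff f l ≈ 0#) → (ζ ^ᶠ s) ^ᶠ l * coeff f l ≈ coeff f l
    fixed l (yes f[l]≈0) = trans (*-congˡ f[l]≈0) (trans (zeroʳ _) (sym f[l]≈0))
    fixed l (no  f[l]≉0) =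
      trans (*-congʳ (trans (^ᶠ-assocʳ ζ s l) (ω^[s*l]≈1 ζ-prim (f-supported l f[l]≉0)))) (*-identityˡ _)

  twist : ℕ → Pol
  twist j = ξ ^ᶠ (j ℕ.* n) ·ₚ scale (ζ ^ᶠ j) f

  twist-monic : ∀ j → MonicOfDegree (twist j) n
  twist-monic j = lead , ·ₚ-degreeAtMost _ {scale (ζ ^ᶠ j) f} (scale-degreeAtMost _ {f} (proj₂ f-monic))
    where
    open ≈-Reasoning
    lead : coeff (twist j) n ≈ 1#
    lead = begin
      coeff (twist j) n                               ≈⟨ trans (coeff-·ₚ _ (scale (ζ ^ᶠ j) f) n) (*-congˡ (coeff-scale (ζ ^ᶠ j) f n)) ⟩
      ξ ^ᶠ (j ℕ.* n) * ((ζ ^ᶠ j) ^ᶠ n * coeff f n)    ≈⟨ *-congˡ (*-cong (^ᶠ-assocʳ ζ j n) (proj₁ f-monic)) ⟩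
      ξ ^ᶠ (j ℕ.* n) * (ζ ^ᶠ (j ℕ.* n) * 1#)          ≈⟨ *-congˡ (*-identityʳ _) ⟩
      ξ ^ᶠ (j ℕ.* n) * ζ ^ᶠ (j ℕ.* n)                 ≈⟨ *-comm _ _ ⟩
      ζ ^ᶠ (j ℕ.* n) * ξ ^ᶠ (j ℕ.* n)                 ≈⟨ ζʲ*ξʲ≈1 (j ℕ.* n) ⟩
      1#                                              ∎

  ⟦twist⟧ : ∀ j y → ⟦ twist j ⟧ y L.≈ ι (ξ ^ᶠ (j ℕ.* n)) L.* ⟦ f ⟧ (ι (ζ ^ᶠ j) L.* y)
  ⟦twist⟧ j y = L.trans (⟦⟧-·ₚ _ (scale (ζ ^ᶠ j) f) y) (L.*-congˡ (⟦⟧-scale _ f y))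

  twist∣ : ∀ j g → ⟦ g ⟧ (ι (ξ ^ᶠ j) L.* β) L.≈ L.0# → twist j ∣ₚ g
  twist∣ j g g[ξʲβ]≈0 with root⇒f∣ (scale (ξ ^ᶠ j) g) (L.trans (⟦⟧-scale _ g β) g[ξʲβ]≈0)
  ... | q , ξʲg≋fq = b ·ₚ scale (ζ ^ᶠ j) q , (begin
    g                                               ≈⟨ scale-identity g (ζʲ*ξʲ≈1 j) ⟨
    scale (ζ ^ᶠ j * ξ ^ᶠ j) g                       ≈⟨ scale-scale (ζ ^ᶠ j) (ξ ^ᶠ j) g ⟨
    scale (ζ ^ᶠ j) (scale (ξ ^ᶠ j) g)               ≈⟨ ≋-trans (scale-cong refl ξʲg≋fq) (scale-*ₚ (ζ ^ᶠ j) f q) ⟩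
    ζʲf *ₚ ζʲq                                      ≈⟨ ≋-trans (·ₚ-cong (trans (*-comm a b) (ζʲ*ξʲ≈1 (j ℕ.* n))) ≋-refl) (·ₚ-identityˡ _) ⟨
    (a * b) ·ₚ (ζʲf *ₚ ζʲq)                         ≈⟨ ≋-trans (·ₚ-assoc a b _) (·ₚ-congˡ a (≋-sym (*ₚ-·ₚʳ b ζʲf ζʲq))) ⟩
    a ·ₚ (ζʲf *ₚ (b ·ₚ ζʲq))                        ≈⟨ *ₚ-·ₚˡ a ζʲf (b ·ₚ ζʲq) ⟨
    twist j *ₚ (b ·ₚ ζʲq)                           ∎)
    where
    open ≋-Reasoning
    a = ξ ^ᶠ (j ℕ.* n)
    b = ζ ^ᶠ (j ℕ.* n)
    ζʲf = scale (ζ ^ᶠ j) f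
    ζʲq = scale (ζ ^ᶠ j) q

  f[0]≉0 : ¬ (coeff f 0 ≈ 0#)
  f[0]≉0 = irreducible-coeff0≉0 {f} f-monic f-irr f≉X

  -- If ξ^i β is a root of f, then f(ξ^i X) is a scalar multiple of f, and the scalar is 1 by f(0) ≠ 0.
  k∣i*support : ∀ i → ⟦ f ⟧ (ι (ξ ^ᶠ i) L.* β) L.≈ L.0# → ∀ l → ¬ (coeff f l ≈ 0#) → k ∣ i ℕ.* l
  k∣i*support i f[ξⁱβ]≈0 with root⇒f∣ (scale (ξ ^ᶠ i) f) (L.trans (⟦⟧-scale _ f β) f[ξⁱβ]≈0)
  ... | q , ξⁱf≋fq = λ l f[l]≉0 →
    ω^l≈1⇒k∣l ξ-prim (i ℕ.* l) (trans (sym (^ᶠ-assocʳ ξ i l)) (trans (scale≋·ₚ⇒^ᶠ≈ ξⁱf≋q₀f f[l]≉0) q₀≈1))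
    where
    ξⁱf-degree : HasDegree (scale (ξ ^ᶠ i) f) n
    ξⁱf-degree = (λ lead≈0 → *-≉0 (x^ᶠn≉0 n (x^ᶠn≉0 i (ω≉0 ξ-prim))) f-lead≉0 (trans (sym (coeff-scale _ f n)) lead≈0))
               , scale-degreeAtMost _ {f} (proj₂ f-monic)
    q≋const : q ≋ const (coeff q 0)
    q≋const = proj₂ (factor-of-no-larger-degree {p = f} ξⁱf≋fq (monic⇒hasDegree {f} f-monic) ξⁱf-degree ℕP.≤-refl)
    ξⁱf≋q₀f : scale (ξ ^ᶠ i) f ≋ coeff q 0 ·ₚ f
    ξⁱf≋q₀f = ≋-trans ξⁱf≋fq (≋-trans (*ₚ-congˡ f q≋const) (≋-trans (*ₚ-comm f _) (const-*ₚ _ f)))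
    q₀≈1 : coeff q 0 ≈ 1#
    q₀≈1 = sym (scale≋·ₚ⇒^ᶠ≈ ξⁱf≋q₀f f[0]≉0)

  supportedOnMultiples⇒compression : ∀ {m} → 0 < m → SupportedOnMultiples m f → m ∣ k → IsCompression f n k m
  supportedOnMultiples⇒compression {suc m} _ f∈ m∣k =
    gcd-greatest (f∈ n f-lead≉0) m∣k , deflate m n f , ≋⇒≈ₚ (≋-inflate-deflate m n f (proj₂ f-monic) f∈)

  f[ξⁱβ]≉0 : ∀ {i} → 0 < i → i < s → ¬ (⟦ f ⟧ (ι (ξ ^ᶠ i) L.* β) L.≈ L.0#)
  f[ξⁱβ]≉0 {i} 0<i i<s f[ξⁱβ]≈0 =
    ℕP.<⇒≱ (t<coarsening 0<t) (proj₂ t-max coarsening (supportedOnMultiples⇒compression 0<coarsening f∈ coarsening∣k))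
    where
    open Coarsening i s t 0<i i<s
    0<coarsening : 0 < coarsening
    0<coarsening = ℕP.<-trans 0<t (t<coarsening 0<t)
    coarsening∣k : coarsening ∣ k
    coarsening∣k = ≡.subst (coarsening ∣_) (≡.sym k≡s*t) coarsening∣s*t
    f∈ : SupportedOnMultiples coarsening f
    f∈ l f[l]≉0 = coarsening∣ l (≡.subst (_∣ i ℕ.* l) k≡s*t (k∣i*support i f[ξⁱβ]≈0 l f[l]≉0)) (f-supported l f[l]≉0)

  twist[ξʲβ]≉0 : ∀ {i j} → 0 < i → i < j → j ≤ s → ¬ (⟦ twist i ⟧ (ι (ξ ^ᶠ j) L.* β) L.≈ L.0#)
  twist[ξʲβ]≉0 {i} {j} 0<i i<j j≤s twist[ξʲβ]≈0 =
    LF.*-≉0 (ι-≉0 (x^ᶠn≉0 (i ℕ.* n) (ω≉0 ξ-prim)))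
            (λ f≈0 → f[ξⁱβ]≉0 (ℕP.m<n⇒0<n∸m i<j) j∸i<s (L.trans (⟦⟧-congʳ f (L.sym point)) f≈0))
            (L.trans (L.sym (⟦twist⟧ i _)) twist[ξʲβ]≈0)
    where
    j∸i<s : j ∸ i < s
    j∸i<s = ℕP.<-≤-trans (ℕP.∸-monoʳ-< {o = 0} 0<i (ℕP.<⇒≤ i<j)) j≤s
    ζⁱξʲ≈ξʲ⁻ⁱ : ζ ^ᶠ i * ξ ^ᶠ j ≈ ξ ^ᶠ (j ∸ i)
    ζⁱξʲ≈ξʲ⁻ⁱ = begin
      ζ ^ᶠ i * ξ ^ᶠ j                   ≡⟨ ≡.cong (λ e → ζ ^ᶠ i * ξ ^ᶠ e) (ℕP.m+[n∸m]≡n (ℕP.<⇒≤ i<j)) ⟨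
      ζ ^ᶠ i * ξ ^ᶠ (i ℕ.+ (j ∸ i))     ≈⟨ *-congˡ (^ᶠ-homo-* ξ i (j ∸ i)) ⟩
      ζ ^ᶠ i * (ξ ^ᶠ i * ξ ^ᶠ (j ∸ i))  ≈⟨ *-assoc _ _ _ ⟨
      (ζ ^ᶠ i * ξ ^ᶠ i) * ξ ^ᶠ (j ∸ i)  ≈⟨ trans (*-congʳ (ζʲ*ξʲ≈1 i)) (*-identityˡ _) ⟩
      ξ ^ᶠ (j ∸ i)                      ∎
      where open ≈-Reasoning
    point : ι (ζ ^ᶠ i) L.* (ι (ξ ^ᶠ j) L.* β) L.≈ ι (ξ ^ᶠ (j ∸ i)) L.* β
    point = L.trans (L.sym (L.*-assoc _ _ _)) (L.*-congʳ (L.trans (L.sym (ι-* _ _)) (ι-cong ζⁱξʲ≈ξʲ⁻ⁱ)))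

  ∏twist : ℕ → Pol
  ∏twist r = prod1 r twist

  ∏twist-monic : ∀ r → MonicOfDegree (∏twist r) (r ℕ.* n)
  ∏twist-monic zero    = refl , λ { (suc i) _ → refl }
  ∏twist-monic (suc r) = ≡.subst (MonicOfDegree (∏twist (suc r))) (ℕP.+-comm (r ℕ.* n) n)
                                 (*ₚ-monic {∏twist r} {twist (suc r)} (∏twist-monic r) (twist-monic (suc r)))

  ∏twist[ξʲβ]≉0 : ∀ r {j} → r < j → j ≤ s → ¬ (⟦ ∏twist r ⟧ (ι (ξ ^ᶠ j) L.* β) L.≈ L.0#)
  ∏twist[ξʲβ]≉0 zero    _   _   ∏≈0 = L.1≉0 (L.trans (L.sym (L.trans (⟦⟧-const 1# _) ι-1)) ∏≈0)
  ∏twist[ξʲβ]≉0 (suc r) r<j j≤s ∏≈0 =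
    LF.*-≉0 (∏twist[ξʲβ]≉0 r (ℕP.<-trans (ℕP.n<1+n r) r<j) j≤s) (twist[ξʲβ]≉0 (s≤s z≤n) r<j j≤s)
            (L.trans (L.sym (⟦⟧-*ₚ (∏twist r) (twist (suc r)) _)) ∏≈0)

  ∏twist∣ : ∀ {g} → (∀ j → ⟦ g ⟧ (ι (ξ ^ᶠ j) L.* β) L.≈ L.0#) → ∀ r → r ≤ s → ∏twist r ∣ₚ g
  ∏twist∣ {g} _     zero    _   = g , ≋-sym (*ₚ-identityˡ g)
  ∏twist∣ {g} roots (suc r) r<s = extend (∏twist∣ roots r (ℕP.<⇒≤ r<s))
    where
    x = ι (ξ ^ᶠ suc r) L.* β
    extend : ∏twist r ∣ₚ g → ∏twist (suc r) ∣ₚ g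
    extend (q , g≋∏q) =
      let q′ , q≋twist*q′ = twist∣ (suc r) q q[x]≈0 in
      q′ , ≋-trans g≋∏q (≋-trans (*ₚ-congˡ (∏twist r) q≋twist*q′) (≋-sym (*ₚ-assoc (∏twist r) (twist (suc r)) q′)))
      where
      q[x]≈0 : ⟦ q ⟧ x L.≈ L.0#
      q[x]≈0 = LF.x*y≈0⇒y≈0 (∏twist[ξʲβ]≉0 r ℕP.≤-refl r<s)
                 (L.trans (L.sym (⟦⟧-*ₚ (∏twist r) q x)) (L.trans (L.sym (⟦⟧-cong x g≋∏q)) (roots (suc r))))

  inflate-root : ∀ {m} → ⟦ m ⟧ (β LP.^ᶠ k) L.≈ L.0# → ∀ j → ⟦ inflate k m ⟧ (ι (ξ ^ᶠ j) L.* β) L.≈ L.0#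
  inflate-root {m} m[βᵏ]≈0 j = begin
    ⟦ inflate k m ⟧ (ι (ξ ^ᶠ j) L.* β)               ≈⟨ ⟦⟧-inflate k m _ ⟩
    ⟦ m ⟧ ((ι (ξ ^ᶠ j) L.* β) LP.^ᶠ k)               ≈⟨ ⟦⟧-congʳ m (LF.^ᶠ-distrib-* _ β k) ⟩
    ⟦ m ⟧ (ι (ξ ^ᶠ j) LP.^ᶠ k L.* β LP.^ᶠ k)         ≈⟨ ⟦⟧-congʳ m (L.*-congʳ ξʲᵏ≈1) ⟩
    ⟦ m ⟧ (L.1# L.* β LP.^ᶠ k)                       ≈⟨ ⟦⟧-congʳ m (L.*-identityˡ _) ⟩
    ⟦ m ⟧ (β LP.^ᶠ k)                                ≈⟨ m[βᵏ]≈0 ⟩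
    L.0#                                             ∎
    where
    open L-Reasoning
    ξʲᵏ≈1 : ι (ξ ^ᶠ j) LP.^ᶠ k L.≈ L.1#
    ξʲᵏ≈1 = L.trans (L.sym (ι-^ᶠ _ k)) (L.trans (ι-cong (trans (^ᶠ-assocʳ ξ j k) (ω^[a*k]≈1 ξ-prim j))) ι-1)

  ∏twist-root : ⟦ ∏twist s ⟧ β L.≈ L.0#
  ∏twist-root = ⟦⟧-prod1-root s twist 0<s (L.trans (⟦twist⟧ s β) (L.trans (L.*-congˡ f[ζˢβ]≈0) (L.zeroʳ _)))
    where
    f[ζˢβ]≈0 : ⟦ f ⟧ (ι (ζ ^ᶠ s) L.* β) L.≈ L.0#
    f[ζˢβ]≈0 = L.trans (L.sym (⟦⟧-scale _ f β)) (L.trans (⟦⟧-cong β scale-ζˢ-f) f[β]≈0)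

  scale-twist : ∀ j → scale ζ (twist j) ≋ ζ ^ᶠ n ·ₚ twist (suc j)
  scale-twist j = begin
    scale ζ (ξ ^ᶠ (j ℕ.* n) ·ₚ scale (ζ ^ᶠ j) f)           ≈⟨ ≋-trans (scale-·ₚ ζ _ _) (·ₚ-congˡ _ (scale-scale ζ (ζ ^ᶠ j) f)) ⟩
    ξ ^ᶠ (j ℕ.* n) ·ₚ scale (ζ ^ᶠ suc j) f                  ≈⟨ ·ₚ-cong ξʲⁿ≈ζⁿξ⁽ʲ⁺¹⁾ⁿ ≋-refl ⟩
    (ζ ^ᶠ n * ξ ^ᶠ (suc j ℕ.* n)) ·ₚ scale (ζ ^ᶠ suc j) f   ≈⟨ ·ₚ-assoc _ _ _ ⟩
    ζ ^ᶠ n ·ₚ twist (suc j)                                 ∎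
    where
    open ≋-Reasoning
    ξʲⁿ≈ζⁿξ⁽ʲ⁺¹⁾ⁿ : ξ ^ᶠ (j ℕ.* n) ≈ ζ ^ᶠ n * ξ ^ᶠ (suc j ℕ.* n)
    ξʲⁿ≈ζⁿξ⁽ʲ⁺¹⁾ⁿ = sym (trans (*-congˡ (^ᶠ-homo-* ξ n (j ℕ.* n)))
                        (trans (sym (*-assoc _ _ _)) (trans (*-congʳ (ζʲ*ξʲ≈1 n)) (*-identityˡ _))))

  scale-∏twist : ∀ r → scale ζ (∏twist r) ≋ ζ ^ᶠ (r ℕ.* n) ·ₚ prod1 r (λ j → twist (suc j))
  scale-∏twist zero    = mk≋ λ { zero → sym (*-identityʳ _) ; (suc i) → refl }
  scale-∏twist (suc r) = begin
    scale ζ (∏twist r *ₚ twist (suc r))     ≈⟨ ≋-trans (scale-*ₚ ζ (∏twist r) (twist (suc r))) (*ₚ-cong (scale-∏twist r) (scale-twist (suc r))) ⟩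
    (a ·ₚ Π′) *ₚ (b ·ₚ t′)                  ≈⟨ ≋-trans (*ₚ-·ₚˡ a Π′ (b ·ₚ t′)) (·ₚ-congˡ a (*ₚ-·ₚʳ b Π′ t′)) ⟩
    a ·ₚ (b ·ₚ (Π′ *ₚ t′))                  ≈⟨ ·ₚ-assoc a b (Π′ *ₚ t′) ⟨
    (a * b) ·ₚ (Π′ *ₚ t′)                   ≈⟨ ·ₚ-cong (trans (*-comm a b) (sym (^ᶠ-homo-* ζ n (r ℕ.* n)))) ≋-refl ⟩
    ζ ^ᶠ (suc r ℕ.* n) ·ₚ (Π′ *ₚ t′)        ∎
    where
    open ≋-Reasoning
    a = ζ ^ᶠ (r ℕ.* n)
    b = ζ ^ᶠ n
    Π′ = prod1 r (λ j → twist (suc j))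
    t′ = twist (suc (suc r))

  twist-periodic : twist (suc s) ≋ twist 1
  twist-periodic = begin
    ξ ^ᶠ (suc s ℕ.* n) ·ₚ scale (ζ * ζ ^ᶠ s) f     ≈⟨ ·ₚ-cong ξ⁽ˢ⁺¹⁾ⁿ≈ξⁿ (≋-sym (scale-scale ζ (ζ ^ᶠ s) f)) ⟩
    ξ ^ᶠ (1 ℕ.* n) ·ₚ scale ζ (scale (ζ ^ᶠ s) f)   ≈⟨ ·ₚ-congˡ _ (scale-cong (sym (*-identityʳ ζ)) scale-ζˢ-f) ⟩
    twist 1                                        ∎
    where
    open ≋-Reasoning
    ξ⁽ˢ⁺¹⁾ⁿ≈ξⁿ : ξ ^ᶠ (suc s ℕ.* n) ≈ ξ ^ᶠ (1 ℕ.* n)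
    ξ⁽ˢ⁺¹⁾ⁿ≈ξⁿ = trans (^ᶠ-homo-* ξ n (s ℕ.* n))
                 (trans (*-congˡ (ω^[s*l]≈1 ξ-prim (f-supported n f-lead≉0)))
                 (trans (*-identityʳ _) (reflexive (≡.cong (ξ ^ᶠ_) (≡.sym (ℕP.*-identityˡ n))))))

  scale-ζ-∏twist : scale ζ (∏twist s) ≋ ∏twist s
  scale-ζ-∏twist = begin
    scale ζ (∏twist s)                               ≈⟨ scale-∏twist s ⟩
    ζ ^ᶠ (s ℕ.* n) ·ₚ prod1 s (λ j → twist (suc j))  ≈⟨ ·ₚ-cong (ω^[s*l]≈1 ζ-prim (f-supported n f-lead≉0)) (prod1-rotate s twist twist-periodic) ⟩
    1# ·ₚ ∏twist s                                   ≈⟨ ·ₚ-identityˡ _ ⟩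
    ∏twist s                                         ∎
    where open ≋-Reasoning

  ∏twist-supported : SupportedOnMultiples k (∏twist s)
  ∏twist-supported l ∏[l]≉0 =
    ω^l≈1⇒k∣l ζ-prim l (scale≋·ₚ⇒^ᶠ≈ (≋-trans scale-ζ-∏twist (≋-sym (·ₚ-identityˡ _))) ∏[l]≉0)

  n/t : ℕ
  n/t = ℕD.quotient (f-supported n f-lead≉0)

  s*n≡n/t*k : s ℕ.* n ≡ n/t ℕ.* k
  s*n≡n/t*k = begin
    s ℕ.* n               ≡⟨ ≡.cong (s ℕ.*_) (ℕD.m∣n⇒n≡quotient*m (f-supported n f-lead≉0)) ⟩
    s ℕ.* (n/t ℕ.* t)     ≡⟨ x∙yz≈y∙xz s n/t t ⟩
    n/t ℕ.* (s ℕ.* t)     ≡⟨ ≡.cong (n/t ℕ.*_) k≡s*t ⟨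
    n/t ℕ.* k             ∎
    where
    open ≡.≡-Reasoning
    open import Algebra.Properties.CommutativeSemigroup ℕP.*-commutativeSemigroup using (x∙yz≈y∙xz)

  deflated : Pol
  deflated = deflate k′ (n/t ℕ.* k) (∏twist s)

  ∏twist-s-monic : MonicOfDegree (∏twist s) (n/t ℕ.* k)
  ∏twist-s-monic = ≡.subst (MonicOfDegree (∏twist s)) s*n≡n/t*k (∏twist-monic s)

  ∏twist≋inflate-deflated : ∏twist s ≋ inflate k deflated
  ∏twist≋inflate-deflated = ≋-inflate-deflate k′ (n/t ℕ.* k) (∏twist s) (proj₂ ∏twist-s-monic) ∏twist-supported

  deflated-monic : MonicOfDegree deflated n/t
  deflated-monic = deflate-monic k′ n/t (∏twist s) ∏twist-s-monic

  deflated-degree : HasDegree deflated n/t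
  deflated-degree = monic⇒hasDegree {deflated} deflated-monic

  deflated[βᵏ]≈0 : ⟦ deflated ⟧ (β LP.^ᶠ k) L.≈ L.0#
  deflated[βᵏ]≈0 = L.trans (L.sym (⟦⟧-inflate k deflated β))
                           (L.trans (L.sym (⟦⟧-cong β ∏twist≋inflate-deflated)) ∏twist-root)

  module _ {m : Pol} (m-minimal : IsMinimalPolynomial K L ι (β LP.^ᶠ k) m) where
    private
      d = proj₁ m-minimal
      m-monic = proj₁ (proj₂ m-minimal)

    minpoly-degree≤n/t : d ≤ n/t
    minpoly-degree≤n/t with proj₂ (proj₂ (proj₂ m-minimal)) deflated (n/t , proj₁ deflated-degree) deflated[βᵏ]≈0
    ... | e , e-degree , d≤e = ≡.subst (d ≤_) (hasDegree-unique {deflated} e-degree deflated-degree) d≤e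

    inflate-minpoly≋∏twist : inflate k m ≋ ∏twist s
    inflate-minpoly≋∏twist with ∏twist∣ (inflate-root {m} (proj₁ (proj₂ (proj₂ m-minimal)))) s ℕP.≤-refl
    ... | q , M≋∏q = ≋-trans M≋q₀∏ (≋-trans (·ₚ-cong q₀≈1 ≋-refl) (·ₚ-identityˡ _))
      where
      M-monic : MonicOfDegree (inflate k m) (d ℕ.* k)
      M-monic = inflate-monic k′ {m} m-monic
      dk≤sn : d ℕ.* k ≤ s ℕ.* n
      dk≤sn = ≡.subst (d ℕ.* k ≤_) (≡.sym s*n≡n/t*k) (ℕP.*-monoˡ-≤ k minpoly-degree≤n/t)
      dk≡sn×q≋const : d ℕ.* k ≡ s ℕ.* n × q ≋ const (coeff q 0)
      dk≡sn×q≋const = factor-of-no-larger-degree {p = ∏twist s} M≋∏q (monic⇒hasDegree {∏twist s} (∏twist-monic s))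
                                                 (monic⇒hasDegree {inflate k m} M-monic) dk≤sn
      M≋q₀∏ : inflate k m ≋ coeff q 0 ·ₚ ∏twist s
      M≋q₀∏ = ≋-trans M≋∏q (≋-trans (*ₚ-congˡ (∏twist s) (proj₂ dk≡sn×q≋const)) (≋-trans (*ₚ-comm _ _) (const-*ₚ _ _)))
      q₀≈1 : coeff q 0 ≈ 1#
      q₀≈1 = begin
        coeff q 0                                    ≈⟨ *-identityʳ _ ⟨
        coeff q 0 * 1#                               ≈⟨ *-congˡ (proj₁ (∏twist-monic s)) ⟨
        coeff q 0 * coeff (∏twist s) (s ℕ.* n)       ≡⟨ ≡.cong (λ e → coeff q 0 * coeff (∏twist s) e) (proj₁ dk≡sn×q≋const) ⟨
        coeff q 0 * coeff (∏twist s) (d ℕ.* k)       ≈⟨ trans (≋⇒≈ₚ M≋q₀∏ (d ℕ.* k)) (coeff-·ₚ _ (∏twist s) (d ℕ.* k)) ⟨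
        coeff (inflate k m) (d ℕ.* k)                ≈⟨ proj₁ M-monic ⟩
        1#                                           ∎
        where open ≈-Reasoning

finite⇒≟ : ∀ {c ℓ} (F : Field c ℓ) {q} → HasSize F q → ∀ x y → Dec (Field._≈_ F x y)
finite⇒≟ F F≅Fin x y with Bijection.to F≅Fin x FinP.≟ Bijection.to F≅Fin y
... | yes x↦y = yes (Bijection.injective F≅Fin x↦y)
... | no  x↦̸y = no λ x≈y → x↦̸y (Bijection.cong F≅Fin x≈y)

1<primePower : ∀ {q} → IsPrimePower q → 1 < q
1<primePower (p , e , prime {{p-nontrivial}} _ , 1≤e , ≡.refl) =
  ℕP.<-≤-trans (ℕ.nonTrivial⇒n>1 p)
    (ℕP.≤-trans (ℕP.≤-reflexive (≡.sym (ℕP.*-identityʳ p))) (ℕP.^-monoʳ-≤ p {{ℕ.nonTrivial⇒nonZero p}} 1≤e))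

open import Data.Nat using (_*_)

corollary2 : ∀ {c ℓ c' ℓ' : Level} (q k n : ℕ) (K : Field c ℓ) (L : Field c' ℓ') →
    IsPrimePower q → HasSize K q → HasSize L (q ^ n) →
    (ι : Field.Carrier K → Field.Carrier L) → IsFieldHom K L ι →
    k ∣ q ∸ 1 →
    (ζ : Field.Carrier K) → Poly.IsPrimitiveRoot K k ζ →
    (f : Poly.Pol K) → ¬ (Poly._≈ₚ_ K f (Poly.X K)) →
    Poly.MonicOfDegree K f n → Poly.Irreducible K f →
    (β : Field.Carrier L) → IsRootOf K L ι β f →
    (m : Poly.Pol K) → IsMinimalPolynomial K L ι (Poly._^ᶠ_ L β k) m →
    (t s : ℕ) → Poly.IsMaxCompression K f n k t → k ≡ s * t →
    let open Poly K in
    compose m (X ^ₚ k) ≈ₚ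
      prod1 s (λ j → ((Field._⁻¹ K ζ) ^ᶠ (j * n)) ·ₚ compose f ((ζ ^ᶠ j) ·ₚ X))
corollary2 q zero n K L q-pp _ _ _ _ 0∣q∸1 _ _ _ _ _ _ _ _ _ _ _ _ _ _ =
  ⊥-elim (ℕP.<⇒≱ (1<primePower q-pp) (ℕP.m∸n≡0⇒m≤n (ℕD.0∣⇒≡0 0∣q∸1)))
corollary2 q (suc k′) n K L _ K-size _ ι ι-hom _ ζ ζ-prim f f≉X f-monic f-irr β f[β]≈0 m m-minimal t s t-max k≡s*t =
  ≋⇒≈ₚ (≋-trans (inflate-minpoly≋∏twist {m} m-minimal)
                (prod1-cong s λ j → ·ₚ-congˡ _ (≋-sym (compose-·ₚX (ζ ^ᶠ j) f))))
  where
  open PolynomialRing K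
  open Poly K using (_^ᶠ_)
  open Substitution K using (compose-·ₚX)
  open MinimalPolynomialOfPower K L ι ι-hom (finite⇒≟ K K-size) k′ ζ-prim {f} {n} f≉X f-monic f-irr f[β]≈0 {t} {s} t-max k≡s*t
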